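{- Let $T$ and $T'$ be finite trees, each having a single centroid, and let $f:E(T)\to E(T')$ be a bijection such that $\theta_{T'}(f(e))=\theta_T(e)$ for every edge $e\in E(T)$ and $\theta_{T'}(\{f(e),f(e')\})=\theta_T(\{e,e'\})$ for all distinct edges $e,e'\in E(T)$. Then $T$ and $T'$ are isomorphic. In other words, a tree with a single centroid is determined (up to isomorphism) by its edge set together with the values $\theta_T(e_i)$ for all edges $e_i$ and $\theta_T(\{e_i,e_k\})$ for all distinct edges $e_i,e_k$.
   Context: For a finite tree $T$ and a set $S\subseteq E(T)$, $\theta_T(S)$ is the partition of $\#V(T)$ whose parts are the numbers of vertices of the connected components of the graph $(V(T),E(T)\setminus S)$; for a single edge $e$ write $\theta_T(e)=\theta_T(\{e\})$. The weight of a vertex $v$ of $T$ is the maximal number of edges in any subtree of $T$ containing $v$ as a leaf; the centroid of $T$ is the set of vertices of minimum weight, and $T$ has a single centroid if this set has exactly one element. -}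

module Defs where

open import Data.Nat using (ℕ; zero; suc; _+_; _<_; _≤_; _<ᵇ_; _⊔_)
open import Data.Bool using (Bool; true; false; _∧_; _∨_; not; if_then_else_)
open import Data.Fin using (Fin; toℕ) renaming (zero to fzero; suc to fsuc)
open import Data.Fin.Properties using (_≟_)
open import Data.Fin.Patterns using (0F)
open import Data.Vec using (Vec; []; _∷_; lookup)
open import Data.Bool.ListAction using (any)
open import Data.List using (List; []; _∷_; map; foldr; filterᵇ; length; concatMap; allFin)
open import Data.Product using (Σ; _×_; _,_; proj₁; proj₂)
open import Data.Sum using (_⊎_)
open import Relation.Nullary using (¬_)
open import Relation.Nullary.Decidable using (⌊_⌋)
open import Relation.Binary.PropositionalEquality using (_≡_; _≢_)
open import Function.Definitions using (Injective)
open import Function.Bundles using (_↔_; _⇔_; Inverse)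

-- Finite (multi)graphs: vertices Fin n, edges Fin m, each edge has two
-- endpoints.  (Trees below are forced to be simple by acyclicity.)

record Graph : Set where
  field
    n    : ℕ
    m    : ℕ
    ends : Fin m → Fin n × Fin n
open Graph public

V : Graph → Set
V G = Fin (n G)

E : Graph → Set
E G = Fin (m G)

_==_ : ∀ {k} → Fin k → Fin k → Bool
x == y = ⌊ x ≟ y ⌋

incident : (G : Graph) → V G → E G → Bool
incident G x e = (x == proj₁ (ends G e)) ∨ (x == proj₂ (ends G e))

-- Reachability in (V, E ∖ S), where S : E G → Bool is the removed set.
-- walk≤ G S k u v : there is a walk of length ≤ k from u to v using only
-- edges not in S.

walk≤ : (G : Graph) → (E G → Bool) → ℕ → V G → V G → Bool
walk≤ G S zero    u v = u == v
walk≤ G S (suc k) u v = walk≤ G S k u v ∨ any step (allFin (m G))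
  where
  step : E G → Bool
  step e = not (S e) ∧
           ((walk≤ G S k u (proj₁ (ends G e)) ∧ (proj₂ (ends G e) == v)) ∨
            (walk≤ G S k u (proj₂ (ends G e)) ∧ (proj₁ (ends G e) == v)))

-- u and v lie in the same connected component of (V, E ∖ S)
-- (a walk of length ≤ #V exists iff any walk exists).
conn : (G : Graph) → (E G → Bool) → V G → V G → Bool
conn G S u v = walk≤ G S (n G) u v

countᵇ : ∀ {A : Set} → (A → Bool) → List A → ℕ
countᵇ p xs = length (filterᵇ p xs)

compSize : (G : Graph) → (E G → Bool) → V G → ℕ
compSize G S v = countᵇ (conn G S v) (allFin (n G))

isRep : (G : Graph) → (E G → Bool) → V G → Bool
isRep G S v = not (any (λ u → (toℕ u <ᵇ toℕ v) ∧ conn G S u v) (allFin (n G)))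

-- θ_G(S): the multiset (list up to permutation) of the numbers of
-- vertices of the connected components of (V(G), E(G) ∖ S).
θ : (G : Graph) → (E G → Bool) → List ℕ
θ G S = map (compSize G S) (filterᵇ (isRep G S) (allFin (n G)))

single : ∀ {k} → Fin k → Fin k → Bool
single e x = x == e

pair : ∀ {k} → Fin k → Fin k → Fin k → Bool
pair e e' x = (x == e) ∨ (x == e')

Connected : Graph → Set
Connected G = ∀ u v → conn G (λ _ → false) u v ≡ true

-- Edge i of a cyclic sequence joins vertex i and vertex i+1 (mod k).
next : ∀ {k} → Fin (suc k) → Fin (suc k)
next {k} i with toℕ i Data.Nat.≟ k
... | Relation.Nullary.yes _ = fzero
... | Relation.Nullary.no ¬p = Data.Fin.fromℕ< (lemma i ¬p)
  where
  open import Data.Nat.Properties using (≤∧≢⇒<; ≤-pred)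
  open import Data.Fin.Properties using (toℕ<n)
  open import Data.Nat using (s≤s)
  lemma : (i : Fin (suc k)) → toℕ i ≢ k → suc (toℕ i) < suc k
  lemma i ne = s≤s (≤∧≢⇒< (≤-pred (toℕ<n i)) ne)

joins : (G : Graph) → E G → V G → V G → Set
joins G e a b = (ends G e ≡ (a , b)) ⊎ (ends G e ≡ (b , a))

record Cycle (G : Graph) (k : ℕ) : Set where
  field
    es       : Fin (suc k) → E G
    vs       : Fin (suc k) → V G
    es-inj   : Injective _≡_ _≡_ es
    vs-inj   : Injective _≡_ _≡_ vs
    adjacent : ∀ i → joins G (es i) (vs i) (vs (next i))

Acyclic : Graph → Set
Acyclic G = ∀ k → ¬ Cycle G k

record IsTree (G : Graph) : Set where
  field
    nonempty  : 1 ≤ n G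
    connected : Connected G
    acyclic   : Acyclic G

allSubsets : ∀ k → List (Vec Bool k)
allSubsets zero    = [] ∷ []
allSubsets (suc k) = concatMap (λ s → (false ∷ s) ∷ (true ∷ s) ∷ []) (allSubsets k)

degIn : (G : Graph) → Vec Bool (m G) → V G → ℕ
degIn G F v = countᵇ (λ e → lookup F e ∧ incident G v e) (allFin (m G))

touched : (G : Graph) → Vec Bool (m G) → V G → Bool
touched G F x = any (λ e → lookup F e ∧ incident G x e) (allFin (m G))

-- F (with the vertices it touches) is a subtree of the tree G containing
-- v as a leaf: it is connected (acyclicity is inherited from G) and v has
-- degree exactly 1 in it.
leafSubtree : (G : Graph) → V G → Vec Bool (m G) → Bool
leafSubtree G v F =
  ⌊ degIn G F v Data.Nat.≟ 1 ⌋ ∧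
  not (any (λ x → any (λ y → touched G F x ∧ touched G F y ∧
                              not (conn G (λ e → not (lookup F e)) x y))
                      (allFin (n G)))
           (allFin (n G)))

-- weight of v: maximal number of edges of a subtree containing v as a
-- leaf (0 if there is none, i.e. for the one-vertex tree).
weight : (G : Graph) → V G → ℕ
weight G v = foldr _⊔_ 0
  (map (λ F → if leafSubtree G v F then countᵇ (λ e → lookup F e) (allFin (m G)) else 0)
       (allSubsets (m G)))

-- the set of vertices of minimum weight has exactly one element
SingleCentroid : Graph → Set
SingleCentroid G = Σ (V G) λ c → ∀ v → v ≢ c → weight G c < weight G v

-- Isomorphism of graphs (simple graphs: adjacency-preserving bijection).

Adj : (G : Graph) → V G → V G → Set
Adj G a b = Σ (E G) λ e → joins G e a b

Isomorphic : Graph → Graph → Set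
Isomorphic G H = Σ (V G ↔ V H) λ φ →
  ∀ a b → Adj G a b ⇔ Adj H (Inverse.to φ a) (Inverse.to φ b)

module Submission where

-- Root a tree at a vertex c.  Removing an edge e cuts off its lower end;
-- `below e` is the set of vertices cut off, `size e` its cardinality, and
-- g is `nested` in e when lower g is below e.  The proof has three parts.
-- (1) The tree is determined by `nested` (module Nesting, Rooted): the
--     vertices are c and the lower ends, and the upper end of e is c or
--     the lower end of the least edge containing e.
-- (2) θ(e) = {n - size e, size e} (Profile).  If every subtree is smaller
--     than its complement, g is nested in e iff size e ∉ θ({e, g}).
-- (3) Rooted at the single centroid, every subtree is smaller than its
--     complement (Centroid: compare the weights of c and of the lower end
--     of a largest subtree).
-- So the edge bijection preserves sizes and nesting, hence induces an
-- isomorphism.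

open import Defs
open import Data.Nat using (_+_; _<?_; _<_; _<ᵇ_; _≤?_; _≤_; _⊔_; suc; s≤s; zero; z≤n; ℕ)
open import Data.Nat.Properties using (+-cancelˡ-≤; +-monoˡ-≤; +-suc; <-asym; <-cmp; <-irrefl; <ᵇ⇒<; <⇒<ᵇ; <⇒≤; m≤m⊔n; m≤n⇒m<n∨m≡n; m≤n⇒m≤1+n; m≤n⇒m⊔n≡n; m≤n⊔m; n≤1+n; ≤-pred; ≤-refl; ≤-reflexive; ≤-trans; ≤∧≢⇒<; ≮⇒≥; ≰⇒>; ⊔-lub)
open import Data.Bool using (Bool; T; _∧_; _∨_; false; if_then_else_; not; true)
open import Data.Unit using (tt; ⊤)
open import Data.Bool.Properties using (T?; not-involutive; ∧-comm; ∧-zeroʳ; ∨-comm)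
open import Data.Fin using (Fin; fromℕ; inject₁; toℕ) renaming (zero to fzero; suc to fsuc)
open import Data.List using (List; []; _∷_; allFin; filterᵇ; foldr; map; tabulate)
open import Data.Product using (_,_; _×_; proj₁; proj₂; Σ)
open import Data.Sum using (_⊎_; inj₁; inj₂)
open import Data.Empty using (⊥; ⊥-elim)
open import Relation.Nullary using (no; yes; ¬_)
open import Relation.Binary.PropositionalEquality
open import Data.Bool.ListAction using (any)
open import Data.Vec using (Vec; []; _∷_; lookup)
open import Function.Base using (_∘_)
open import Data.List.Properties using (map-cong; map-∘)
open import Data.List.Membership.Propositional using (_∈_; _∉_; find; lose)
open import Data.List.Membership.Propositional.Properties using (∈-allFin; ∈-concatMap⁺; ∈-filter⁺; ∈-filter⁻; ∈-map⁺; ∈-map⁻)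
open import Data.List.Membership.Propositional.Properties.WithK using (unique∧set⇒bag)
open import Data.List.Relation.Binary.BagAndSetEquality using (∼bag⇒↭)
open import Data.List.Relation.Unary.Any using (Any; here; there)
open import Data.List.Relation.Unary.AllPairs using (AllPairs; []; _∷_)
open import Data.List.Relation.Unary.Unique.Propositional using (Unique)
open import Data.List.Relation.Binary.Permutation.Propositional using (_↭_; ↭-reflexive; ↭-sym; ↭-trans)
open import Function.Bundles using (Equivalence; Inverse; _↔_; _⇔_; mk↔ₛ′; mk⇔)
open import Relation.Binary.Definitions using (tri<; tri>; tri≈)
open import Data.List.Relation.Unary.All using ([]; _∷_)
open import Data.List.Relation.Binary.Permutation.Propositional.Properties using (∈-resp-↭)
open import Relation.Nullary.Decidable using (fromWitness; toWitness; ⌊_⌋)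
open import Data.Vec.Properties using (lookup∘tabulate)
open import Function.Properties.Inverse using (↔-sym; ↔-trans)
open import Function.Construct.Symmetry using (⇔-sym)
open import Function.Construct.Composition using (_⇔-∘_)
import Data.Fin.Properties as FP
import Data.List.Relation.Unary.AllPairs as AllPairs
import Data.List.Relation.Unary.AllPairs.Properties as AllPairs
import Data.List.Relation.Unary.Unique.Propositional.Properties as Unique
import Data.List.Relation.Binary.Permutation.Propositional.Properties as Perm

t≢f : true ≢ false
t≢f ()

∧-l : ∀ {a b} → (a ∧ b) ≡ true → a ≡ true
∧-l {true} _ = refl

∧-r : ∀ {a b} → (a ∧ b) ≡ true → b ≡ true
∧-r {true} e = e

∧-i : ∀ {a b} → a ≡ true → b ≡ true → (a ∧ b) ≡ true
∧-i refl refl = refl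

∨-e : ∀ {a b} → (a ∨ b) ≡ true → a ≡ true ⊎ b ≡ true
∨-e {true} _ = inj₁ refl
∨-e {false} e = inj₂ e

∨-l : ∀ {a} b → a ≡ true → (a ∨ b) ≡ true
∨-l b refl = refl

∨-r : ∀ a {b} → b ≡ true → (a ∨ b) ≡ true
∨-r true _ = refl
∨-r false e = e

∨-false₁ : ∀ {a b} → (a ∨ b) ≡ false → a ≡ false
∨-false₁ {false} _ = refl

∨-false₂ : ∀ {a b} → (a ∨ b) ≡ false → b ≡ false
∨-false₂ {false} e = e

not-t : ∀ {a} → not a ≡ true → a ≡ false
not-t {false} _ = refl

not-f : ∀ {a} → a ≡ false → not a ≡ true
not-f refl = refl

f→¬t : ∀ {a} → a ≡ false → ¬ (a ≡ true)
f→¬t refl ()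

¬t→f : ∀ {a} → ¬ (a ≡ true) → a ≡ false
¬t→f {true} n = ⊥-elim (n refl)
¬t→f {false} _ = refl

T→≡ : ∀ {b} → T b → b ≡ true
T→≡ {true} _ = refl

≡→T : ∀ {b} → b ≡ true → T b
≡→T refl = tt

iff→≡ : ∀ {a b : Bool} → (a ≡ true → b ≡ true) → (b ≡ true → a ≡ true) → a ≡ b
iff→≡ {true} f g = sym (f refl)
iff→≡ {false} {true} f g = g refl
iff→≡ {false} {false} f g = refl

==-refl : ∀ {k} (x : Fin k) → (x == x) ≡ true
==-refl x with x FP.≟ x
... | yes _ = refl
... | no ¬p = ⊥-elim (¬p refl)

==-false : ∀ {k} {x y : Fin k} → x ≢ y → (x == y) ≡ false
==-false {x = x} {y} ne with x FP.≟ y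
... | yes p = ⊥-elim (ne p)
... | no _ = refl

==-sound : ∀ {k} {x y : Fin k} → (x == y) ≡ true → x ≡ y
==-sound {x = x} {y} e with x FP.≟ y
... | yes p = p

==-false⁻ : ∀ {k} {x y : Fin k} → (x == y) ≡ false → x ≢ y
==-false⁻ {x = x} e refl = t≢f (trans (sym (==-refl x)) e)

any-allFin⁻ : ∀ n (p : Fin n → Bool) → any p (allFin n) ≡ true → Σ (Fin n) λ i → p i ≡ true
any-allFin⁻ n p = go n (λ i → i)
  where
  go : ∀ {A : Set} k (f : Fin k → A) {p : A → Bool} → any p (tabulate f) ≡ true → Σ (Fin k) λ i → p (f i) ≡ true
  go zero f ()
  go (suc k) f {p} e with p (f fzero) in eq
  ... | true = fzero , eq
  ... | false = let (i , q) = go k (λ i → f (fsuc i)) e in fsuc i , q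

any-allFin⁺ : ∀ n (p : Fin n → Bool) (i : Fin n) → p i ≡ true → any p (allFin n) ≡ true
any-allFin⁺ n p = go n (λ i → i)
  where
  go : ∀ {A : Set} k (f : Fin k → A) {p : A → Bool} (i : Fin k) → p (f i) ≡ true → any p (tabulate f) ≡ true
  go (suc k) f fzero e rewrite e = refl
  go (suc k) f {p} (fsuc i) e with p (f fzero)
  ... | true = refl
  ... | false = go k (λ i → f (fsuc i)) i e

any-allFin-false : ∀ n (p : Fin n → Bool) → (∀ i → p i ≡ false) → any p (allFin n) ≡ false
any-allFin-false n p h = ¬t→f λ e → let (i , q) = any-allFin⁻ n p e in t≢f (trans (sym q) (h i))

count : ∀ n → (Fin n → Bool) → ℕ
count zero p = 0
count (suc n) p = (if p fzero then 1 else 0) + count n (λ i → p (fsuc i))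

countᵇ-allFin : ∀ n (p : Fin n → Bool) → countᵇ p (allFin n) ≡ count n p
countᵇ-allFin n p = go n (λ i → i)
  where
  go : ∀ {A : Set} k (f : Fin k → A) {p : A → Bool} → countᵇ p (tabulate f) ≡ count k (λ i → p (f i))
  go zero f = refl
  go (suc k) f {p} with p (f fzero)
  ... | true = cong suc (go k (λ i → f (fsuc i)))
  ... | false = go k (λ i → f (fsuc i))

count-cong : ∀ n {p q : Fin n → Bool} → (∀ i → p i ≡ q i) → count n p ≡ count n q
count-cong zero h = refl
count-cong (suc n) h rewrite h fzero = cong (_ +_) (count-cong n (λ i → h (fsuc i)))

count-mono : ∀ n {p q : Fin n → Bool} → (∀ i → p i ≡ true → q i ≡ true) → count n p ≤ count n q
count-mono zero h = z≤n
count-mono (suc n) {p} {q} h with p fzero in e1 | q fzero in e2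
... | true | true = s≤s (count-mono n (λ i → h (fsuc i)))
... | true | false = ⊥-elim (t≢f (trans (sym (h fzero e1)) e2))
... | false | true = m≤n⇒m≤1+n (count-mono n (λ i → h (fsuc i)))
... | false | false = count-mono n (λ i → h (fsuc i))

count-mono-strict : ∀ n {p q : Fin n → Bool} → (∀ i → p i ≡ true → q i ≡ true) →
  (j : Fin n) → p j ≡ false → q j ≡ true → count n p < count n q
count-mono-strict (suc n) {p} {q} h fzero pj qj rewrite pj | qj = s≤s (count-mono n (λ i → h (fsuc i)))
count-mono-strict (suc n) {p} {q} h (fsuc j) pj qj with p fzero in e1 | q fzero in e2
... | true | true = s≤s (count-mono-strict n (λ i → h (fsuc i)) j pj qj)
... | true | false = ⊥-elim (t≢f (trans (sym (h fzero e1)) e2))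
... | false | true = m≤n⇒m≤1+n (count-mono-strict n (λ i → h (fsuc i)) j pj qj)
... | false | false = count-mono-strict n (λ i → h (fsuc i)) j pj qj

count-split : ∀ n (p q : Fin n → Bool) →
  count n p ≡ count n (λ i → p i ∧ q i) + count n (λ i → p i ∧ not (q i))
count-split zero p q = refl
count-split (suc n) p q with p fzero | q fzero
... | true | true = cong suc (count-split n _ _)
... | true | false = trans (cong suc (count-split n _ _)) (sym (+-suc _ _))
... | false | _ = count-split n _ _

count-complement : ∀ n (p : Fin n → Bool) → count n p + count n (λ i → not (p i)) ≡ n
count-complement n p = trans (sym (count-split n (λ _ → true) p)) (count-all n)
  where
  count-all : ∀ n → count n (λ _ → true) ≡ n
  count-all zero = refl
  count-all (suc n) = cong suc (count-all n)

count-pos : ∀ n (p : Fin n → Bool) (i : Fin n) → p i ≡ true → 1 ≤ count n p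
count-pos (suc n) p fzero e rewrite e = s≤s z≤n
count-pos (suc n) p (fsuc i) e with p fzero
... | true = s≤s z≤n
... | false = count-pos n _ i e

count-none : ∀ n (p : Fin n → Bool) → (∀ i → p i ≡ false) → count n p ≡ 0
count-none zero p h = refl
count-none (suc n) p h rewrite h fzero = count-none n _ (λ i → h (fsuc i))

count-singleton : ∀ n (j : Fin n) → count n (λ i → i == j) ≡ 1
count-singleton (suc n) fzero = cong suc (count-none n _ (λ i → ==-false {x = fsuc i} {y = fzero} (λ ())))
count-singleton (suc n) (fsuc j) = trans (count-cong n shift) (count-singleton n j)
  where
  shift : ∀ i → (fsuc i == fsuc j) ≡ (i == j)
  shift i = iff→≡ (λ e → ==-refl-at (FP.suc-injective (==-sound e)))
                  (λ e → ==-refl-at (cong fsuc (==-sound e)))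
    where
    ==-refl-at : ∀ {k} {x y : Fin k} → x ≡ y → (x == y) ≡ true
    ==-refl-at {x = x} refl = ==-refl x

count-witness : ∀ n (p : Fin n → Bool) → 1 ≤ count n p → Σ (Fin n) λ i → p i ≡ true
count-witness (suc n) p h with p fzero in e
... | true = fzero , e
... | false = let (i , q) = count-witness n _ h in fsuc i , q

count-two : ∀ n (p : Fin n → Bool) (i j : Fin n) → i ≢ j → p i ≡ true → p j ≡ true → 2 ≤ count n p
count-two (suc n) p fzero fzero ne _ _ = ⊥-elim (ne refl)
count-two (suc n) p fzero (fsuc j) ne pi pj rewrite pi = s≤s (count-pos n _ j pj)
count-two (suc n) p (fsuc i) fzero ne pi pj rewrite pj = s≤s (count-pos n _ i pi)
count-two (suc n) p (fsuc i) (fsuc j) ne pi pj with p fzero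
... | true = m≤n⇒m≤1+n (count-two n _ i j (λ e → ne (cong fsuc e)) pi pj)
... | false = count-two n _ i j (λ e → ne (cong fsuc e)) pi pj

count-one-unique : ∀ n (p : Fin n → Bool) → count n p ≡ 1 →
  (i j : Fin n) → p i ≡ true → p j ≡ true → i ≡ j
count-one-unique n p c1 i j pi pj with i FP.≟ j
... | yes e = e
... | no ne = ⊥-elim (<-irrefl refl (≤-trans (count-two n p i j ne pi pj) (≤-reflexive c1)))

count-remove : ∀ n (q : Fin n → Bool) (a : Fin n) → q a ≡ true →
  count n q ≡ suc (count n (λ h → q h ∧ not (h == a)))
count-remove n q a qa = trans (count-split n q (λ h → h == a))
  (cong (_+ count n (λ h → q h ∧ not (h == a))) (trans (count-cong n only-a) (count-singleton n a)))
  where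
  only-a : ∀ h → (q h ∧ (h == a)) ≡ (h == a)
  only-a h with h FP.≟ a
  ... | yes refl rewrite qa = refl
  ... | no _ rewrite ∧-comm (q h) false = refl

count-injection : ∀ n m (P : Fin n → Bool) (Q : Fin m → Bool) (g : Fin n → Fin m) →
  (∀ x → P x ≡ true → Q (g x) ≡ true) →
  (∀ x y → P x ≡ true → P y ≡ true → g x ≡ g y → x ≡ y) → count n P ≤ count m Q
count-injection zero m P Q g into inj = z≤n
count-injection (suc n) m P Q g into inj with P fzero in e0
... | false = count-injection n m _ Q (λ i → g (fsuc i)) (λ x → into (fsuc x))
                (λ x y px py e → FP.suc-injective (inj _ _ px py e))
... | true = ≤-trans (s≤s rest) (≤-reflexive (sym (count-remove m Q (g fzero) (into fzero e0))))
  where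
  rest = count-injection n m _ (λ h → Q h ∧ not (h == g fzero)) (λ i → g (fsuc i))
           (λ x px → ∧-i (into (fsuc x) px)
                         (not-f (==-false λ eq → FP.0≢1+n (sym (inj (fsuc x) fzero px e0 eq)))))
           (λ x y px py e → FP.suc-injective (inj _ _ px py e))

joins-sym : ∀ {G : Graph} {h a b} → joins G h a b → joins G h b a
joins-sym (inj₁ x) = inj₂ x
joins-sym (inj₂ y) = inj₁ y

-- Indices of a cycle of length k+1 are either the last one, fromℕ k, whose
-- successor wraps around to 0, or an injected j, whose successor is j+1.
data LastView : ∀ {k} → Fin (suc k) → Set where
  lastV : ∀ {k} → LastView (fromℕ k)
  injV : ∀ {k} (j : Fin k) → LastView (inject₁ j)

view : ∀ {k} (i : Fin (suc k)) → LastView i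
view {zero} fzero = lastV
view {suc k} fzero = injV fzero
view {suc k} (fsuc i) with view i
... | lastV = lastV
... | injV j = injV (fsuc j)

next-last : ∀ k → next (fromℕ k) ≡ fzero
next-last k with toℕ (fromℕ k) Data.Nat.≟ k
... | yes _ = refl
... | no ne = ⊥-elim (ne (FP.toℕ-fromℕ k))

next-inject₁ : ∀ {k} (j : Fin k) → next (inject₁ j) ≡ fsuc j
next-inject₁ {k} j with toℕ (inject₁ j) Data.Nat.≟ k
... | yes e = ⊥-elim (FP.toℕ-inject₁-≢ j (sym e))
... | no ne = FP.toℕ-injective (trans (FP.toℕ-fromℕ< (s≤s (≤∧≢⇒< (≤-pred (FP.toℕ<n (inject₁ j))) ne)))
                                      (cong suc (FP.toℕ-inject₁ j)))

module Walks (G : Graph) where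

  data Walk (S : E G → Bool) (u : V G) : V G → Set where
    nil : Walk S u u
    snoc : ∀ {p v} → Walk S u p → (h : E G) → S h ≡ false → joins G h p v → Walk S u v

  len : ∀ {S u v} → Walk S u v → ℕ
  len nil = 0
  len (snoc w _ _ _) = suc (len w)

  walk≤→Walk : ∀ S k u v → walk≤ G S k u v ≡ true → Walk S u v
  walk≤→Walk S zero u v e rewrite ==-sound e = nil
  walk≤→Walk S (suc k) u v e with ∨-e e
  ... | inj₁ shorter = walk≤→Walk S k u v shorter
  ... | inj₂ step with any-allFin⁻ _ _ step
  ... | h , st with ∨-e (∧-r {not (S h)} st)
  ... | inj₁ x = snoc (walk≤→Walk S k u _ (∧-l x)) h (not-t (∧-l st))
                   (inj₁ (cong (proj₁ (ends G h) ,_) (==-sound (∧-r x))))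
  ... | inj₂ x = snoc (walk≤→Walk S k u _ (∧-l x)) h (not-t (∧-l st))
                   (inj₂ (cong (_, proj₂ (ends G h)) (==-sound (∧-r x))))

  walk≤-mono : ∀ S k l u v → k ≤ l → walk≤ G S k u v ≡ true → walk≤ G S l u v ≡ true
  walk≤-mono S k zero u v Data.Nat.z≤n e = e
  walk≤-mono S k (suc l) u v k≤l e with m≤n⇒m<n∨m≡n k≤l
  ... | inj₂ refl = e
  ... | inj₁ (s≤s k≤l') = ∨-l _ (walk≤-mono S k l u v k≤l' e)

  Walk→walk≤ : ∀ {S u v} (w : Walk S u v) → walk≤ G S (len w) u v ≡ true
  Walk→walk≤ {u = u} nil = ==-refl u
  Walk→walk≤ {S} {u} (snoc {v = v} w h sh jn) = ∨-r (walk≤ G S (len w) u v) (any-allFin⁺ _ _ h (step jn))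
    where
    step : joins G h _ v → (not (S h) ∧ ((walk≤ G S (len w) u (proj₁ (ends G h)) ∧ (proj₂ (ends G h) == v)) ∨
             (walk≤ G S (len w) u (proj₂ (ends G h)) ∧ (proj₁ (ends G h) == v)))) ≡ true
    step (inj₁ eq) rewrite eq | sh | Walk→walk≤ w | ==-refl v = refl
    step (inj₂ eq) rewrite eq | sh | Walk→walk≤ w | ==-refl v = ∨-r _ refl

  -- Paths: walks without repeated vertices, recording their vertices
  -- (most recent first) and edges.
  data Path (S : E G → Bool) (u : V G) : (k : ℕ) → Vec (V G) (suc k) → Vec (E G) k → Set where
    pnil : Path S u 0 (u ∷ []) []
    psnoc : ∀ {k p vs es v} → Path S u k (p ∷ vs) es → (h : E G) → S h ≡ false → joins G h p v →
            (∀ i → lookup (p ∷ vs) i ≢ v) → Path S u (suc k) (v ∷ p ∷ vs) (h ∷ es)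

  PathTo : (S : E G → Bool) (u v : V G) → Set
  PathTo S u v = Σ ℕ λ k → Σ (Vec (V G) k) λ vs → Σ (Vec (E G) k) λ es → Path S u k (v ∷ vs) es

  truncate : ∀ {S u k vs es} → Path S u k vs es → (i : Fin (suc k)) → PathTo S u (lookup vs i)
  truncate pnil fzero = 0 , [] , [] , pnil
  truncate (psnoc {k} {p} {vs} {es} P h sh jn ni) fzero = suc k , p ∷ vs , h ∷ es , psnoc P h sh jn ni
  truncate (psnoc P h sh jn ni) (fsuc i) = truncate P i

  erase : ∀ {S u v} → Walk S u v → PathTo S u v
  erase nil = 0 , [] , [] , pnil
  erase {v = v} (snoc w h sh jn) with erase w
  ... | k , vs , es , P with FP.any? (λ i → lookup (_ ∷ vs) i FP.≟ v)
  ... | yes (i , eq) = subst (PathTo _ _) eq (truncate P i)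
  ... | no fresh = suc k , _ , h ∷ es , psnoc P h sh jn (λ i e → fresh (i , e))

  path-vs-inj : ∀ {S u k vs es} → Path S u k vs es → ∀ i j → lookup vs i ≡ lookup vs j → i ≡ j
  path-vs-inj pnil fzero fzero _ = refl
  path-vs-inj (psnoc P h sh jn ni) fzero fzero _ = refl
  path-vs-inj (psnoc P h sh jn ni) fzero (fsuc j) e = ⊥-elim (ni j (sym e))
  path-vs-inj (psnoc P h sh jn ni) (fsuc i) fzero e = ⊥-elim (ni i e)
  path-vs-inj (psnoc P h sh jn ni) (fsuc i) (fsuc j) e = cong fsuc (path-vs-inj P i j e)

  path→walk : ∀ {S u k v vs es} → Path S u k (v ∷ vs) es → Σ (Walk S u v) λ w → len w ≡ k
  path→walk pnil = nil , refl
  path→walk (psnoc P h sh jn ni) with path→walk P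
  ... | w , l = snoc w h sh jn , cong suc l

  -- A path has at most #V vertices, so the bound #V in `conn` is no
  -- restriction: `conn` holds exactly when a walk exists.
  Walk→conn : ∀ {S u v} → Walk S u v → conn G S u v ≡ true
  Walk→conn {S} {u} {v} w with erase w
  ... | k , vs , es , P with path→walk P
  ... | w' , l = walk≤-mono S (len w') (n G) u v
         (subst (_≤ n G) (sym l) (≤-trans (n≤1+n k) (FP.injective⇒≤ (λ {i} {j} → path-vs-inj P i j))))
         (Walk→walk≤ w')

  conn→Walk : ∀ {S u v} → conn G S u v ≡ true → Walk S u v
  conn→Walk {S} {u} {v} = walk≤→Walk S (n G) u v

  path-first : ∀ {S u k vs es} → Path S u k vs es → lookup vs (fromℕ k) ≡ u
  path-first pnil = refl
  path-first (psnoc P h sh jn ni) = path-first P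

  path-adj : ∀ {S u k vs es} → Path S u k vs es → ∀ j →
    joins G (lookup es j) (lookup vs (inject₁ j)) (lookup vs (fsuc j))
  path-adj (psnoc P h sh jn ni) fzero = joins-sym {G} jn
  path-adj (psnoc P h sh jn ni) (fsuc j) = path-adj P j

  path-avoids : ∀ {S u k vs es} → Path S u k vs es → ∀ j → S (lookup es j) ≡ false
  path-avoids (psnoc P h sh jn ni) fzero = sh
  path-avoids (psnoc P h sh jn ni) (fsuc j) = path-avoids P j

  joins-end : ∀ {h a b x y} → joins G h a b → joins G h x y → (b ≡ x) ⊎ (b ≡ y)
  joins-end (inj₁ e1) (inj₁ e2) = inj₂ (cong proj₂ (trans (sym e1) e2))
  joins-end (inj₁ e1) (inj₂ e2) = inj₁ (cong proj₂ (trans (sym e1) e2))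
  joins-end (inj₂ e1) (inj₁ e2) = inj₁ (cong proj₁ (trans (sym e1) e2))
  joins-end (inj₂ e1) (inj₂ e2) = inj₂ (cong proj₁ (trans (sym e1) e2))

  new-edge : ∀ {S u k p vs es v h} → Path S u k (p ∷ vs) es → joins G h p v →
    (∀ i → lookup (p ∷ vs) i ≢ v) → ∀ j → h ≢ lookup es j
  new-edge {p = p} {vs = vs} {h = h} P jn fresh j eq
    with joins-end jn (subst (λ z → joins G z (lookup (p ∷ vs) (inject₁ j)) (lookup (p ∷ vs) (fsuc j)))
                             (sym eq) (path-adj P j))
  ... | inj₁ x = fresh (inject₁ j) (sym x)
  ... | inj₂ y = fresh (fsuc j) (sym y)

  path-es-inj : ∀ {S u k vs es} → Path S u k vs es → ∀ i j → lookup es i ≡ lookup es j → i ≡ j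
  path-es-inj (psnoc P h sh jn ni) fzero fzero e = refl
  path-es-inj (psnoc P h sh jn ni) fzero (fsuc j) e = ⊥-elim (new-edge P jn ni j e)
  path-es-inj (psnoc P h sh jn ni) (fsuc i) fzero e = ⊥-elim (new-edge P jn ni i (sym e))
  path-es-inj (psnoc P h sh jn ni) (fsuc i) (fsuc j) e = cong fsuc (path-es-inj P i j e)

  -- In an acyclic graph the two ends of an edge e are disconnected once e
  -- is removed: a path between them avoiding e, closed up by e, is a cycle.
  acyclic-cut : Acyclic G → ∀ e a b → joins G e a b → ¬ (conn G (single e) a b ≡ true)
  acyclic-cut acyc e a b jab c with erase (conn→Walk c)
  ... | k , vs , es , P = acyc k cycle
    where
    cycle-edge : (i : Fin (suc k)) → LastView i → E G
    cycle-edge _ lastV = e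
    cycle-edge _ (injV j) = lookup es j
    esf : Fin (suc k) → E G
    esf i = cycle-edge i (view i)
    not-e : ∀ j → lookup es j ≢ e
    not-e j eq = t≢f (trans (sym (subst (λ z → single e z ≡ true) (sym eq) (==-refl e))) (path-avoids P j))
    esf-inj : ∀ {i j} → esf i ≡ esf j → i ≡ j
    esf-inj {i} {j} eq with view i | view j
    ... | lastV | lastV = refl
    ... | lastV | injV j' = ⊥-elim (not-e j' (sym eq))
    ... | injV i' | lastV = ⊥-elim (not-e i' eq)
    ... | injV i' | injV j' = cong inject₁ (path-es-inj P i' j' eq)
    adj : ∀ i → joins G (esf i) (lookup (b ∷ vs) i) (lookup (b ∷ vs) (next i))
    adj i with view i
    ... | lastV rewrite next-last k | path-first P = jab
    ... | injV j rewrite next-inject₁ j = path-adj P j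
    cycle : Cycle G k
    cycle = record { es = esf ; vs = lookup (b ∷ vs) ; es-inj = esf-inj
                   ; vs-inj = λ {i} {j} → path-vs-inj P i j ; adjacent = adj }

  Conn : (E G → Bool) → V G → V G → Set
  Conn S u v = conn G S u v ≡ true

  wcons : ∀ {S u p v} h → S h ≡ false → joins G h u p → Walk S p v → Walk S u v
  wcons h sh jn nil = snoc nil h sh jn
  wcons h sh jn (snoc w h' sh' jn') = snoc (wcons h sh jn w) h' sh' jn'

  wrev : ∀ {S u v} → Walk S u v → Walk S v u
  wrev nil = nil
  wrev (snoc w h sh jn) = wcons h sh (joins-sym {G} jn) (wrev w)

  wapp : ∀ {S u p v} → Walk S u p → Walk S p v → Walk S u v
  wapp w nil = w
  wapp w (snoc w' h sh jn) = snoc (wapp w w') h sh jn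

  wmono : ∀ {S S' u v} → (∀ h → S' h ≡ false → S h ≡ false) → Walk S' u v → Walk S u v
  wmono f nil = nil
  wmono f (snoc w h sh jn) = snoc (wmono f w) h (f h sh) jn

  Conn-refl : ∀ {S} u → Conn S u u
  Conn-refl u = Walk→conn nil

  Conn-sym : ∀ {S u v} → Conn S u v → Conn S v u
  Conn-sym r = Walk→conn (wrev (conn→Walk r))

  Conn-trans : ∀ {S u p v} → Conn S u p → Conn S p v → Conn S u v
  Conn-trans r1 r2 = Walk→conn (wapp (conn→Walk r1) (conn→Walk r2))

  Conn-edge : ∀ {S a b} h → S h ≡ false → joins G h a b → Conn S a b
  Conn-edge h sh jn = Walk→conn (snoc nil h sh jn)

  Conn-mono : ∀ {S S' u v} → (∀ h → S' h ≡ false → S h ≡ false) → Conn S' u v → Conn S u v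
  Conn-mono f r = Walk→conn (wmono f (conn→Walk r))

  Conn-ind : ∀ {S u} (P : V G → Set) → P u →
    (∀ {y z} h → S h ≡ false → joins G h y z → P y → P z) → ∀ {v} → Conn S u v → P v
  Conn-ind P pu step r = go (conn→Walk r)
    where
    go : ∀ {v} → Walk _ _ v → P v
    go nil = pu
    go (snoc w h sh jn) = step h sh jn (go w)

  add : (E G → Bool) → E G → E G → Bool
  add S h h' = S h' ∨ (h' == h)

  Split : (E G → Bool) → V G → V G → V G → V G → Set
  Split S' x a b y = Conn S' x y ⊎ (Conn S' x a × Conn S' y b) ⊎ (Conn S' x b × Conn S' y a)

  split : ∀ S h x y → Conn S x y → Split (add S h) x (proj₁ (ends G h)) (proj₂ (ends G h)) y
  split S h x y = Conn-ind (Split (add S h) x a b) (inj₁ (Conn-refl x)) step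
    where
    a = proj₁ (ends G h)
    b = proj₂ (ends G h)
    extend : ∀ {y z} → Split (add S h) x a b y → Conn (add S h) y z → Split (add S h) x a b z
    extend (inj₁ r) r' = inj₁ (Conn-trans r r')
    extend (inj₂ (inj₁ (r1 , r2))) r' = inj₂ (inj₁ (r1 , Conn-trans (Conn-sym r') r2))
    extend (inj₂ (inj₂ (r1 , r2))) r' = inj₂ (inj₂ (r1 , Conn-trans (Conn-sym r') r2))
    cross-a→b : ∀ {S' a' b'} → Split S' x a' b' a' → Split S' x a' b' b'
    cross-a→b {b' = b'} (inj₁ r) = inj₂ (inj₁ (r , Conn-refl b'))
    cross-a→b {b' = b'} (inj₂ (inj₁ (r , _))) = inj₂ (inj₁ (r , Conn-refl b'))
    cross-a→b (inj₂ (inj₂ (r , _))) = inj₁ r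
    cross-b→a : ∀ {S' a' b'} → Split S' x a' b' b' → Split S' x a' b' a'
    cross-b→a {a' = a'} (inj₁ r) = inj₂ (inj₂ (r , Conn-refl a'))
    cross-b→a (inj₂ (inj₁ (r , _))) = inj₁ r
    cross-b→a {a' = a'} (inj₂ (inj₂ (r , _))) = inj₂ (inj₂ (r , Conn-refl a'))
    step : ∀ {y z} h' → S h' ≡ false → joins G h' y z →
           Split (add S h) x a b y → Split (add S h) x a b z
    step {y} {z} h' sh jn q with h' == h in eq
    ... | false = extend q (Conn-edge h' kept jn)
      where
      kept : (S h' ∨ (h' == h)) ≡ false
      kept rewrite sh | eq = refl
    ... | true with ==-sound eq
    ... | refl with jn
    ... | inj₁ e rewrite e = cross-a→b q
    ... | inj₂ e rewrite e = cross-b→a q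

least-index : ∀ n (p : Fin n → Bool) (i : Fin n) → p i ≡ true →
  Σ (Fin n) λ j → p j ≡ true × (∀ k → toℕ k < toℕ j → p k ≡ false)
least-index (suc n) p i pi with p fzero in e0
... | true = fzero , e0 , λ k ()
... | false with i
...   | fzero = ⊥-elim (t≢f (trans (sym pi) e0))
...   | fsuc i' with least-index n (λ x → p (fsuc x)) i' pi
...     | j , pj , below = fsuc j , pj , earlier
  where
  earlier : ∀ k → toℕ k < toℕ (fsuc j) → p k ≡ false
  earlier fzero _ = e0
  earlier (fsuc k) (s≤s lt) = below k lt

-- θ G S lists the component sizes of (V, E ∖ S) through the least vertex of
-- each component.  Any list of vertices meeting every component exactly
-- once yields the same multiset of sizes.
module Representatives (G : Graph) (S : E G → Bool) where
  open Walks G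

  rep : V G → V G
  rep r = proj₁ (least-index (n G) (λ x → conn G S x r) r (Conn-refl r))

  rep-Conn : ∀ r → Conn S (rep r) r
  rep-Conn r = proj₁ (proj₂ (least-index (n G) (λ x → conn G S x r) r (Conn-refl r)))

  rep-isRep : ∀ r → isRep G S (rep r) ≡ true
  rep-isRep r = not-f (any-allFin-false (n G) _ none-smaller)
    where
    minimal = proj₂ (proj₂ (least-index (n G) (λ x → conn G S x r) r (Conn-refl r)))
    none-smaller : ∀ u → ((toℕ u <ᵇ toℕ (rep r)) ∧ conn G S u (rep r)) ≡ false
    none-smaller u with toℕ u <ᵇ toℕ (rep r) in lt
    ... | false = refl
    ... | true with conn G S u (rep r) in cu
    ...   | false = refl
    ...   | true = ⊥-elim (t≢f (trans (sym (Conn-trans cu (rep-Conn r))) (minimal u (<ᵇ⇒< _ _ (≡→T lt)))))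

  isRep-least : ∀ {x y} → isRep G S y ≡ true → Conn S x y → ¬ (toℕ x < toℕ y)
  isRep-least {x} {y} ry rxy lt =
    t≢f (trans (sym (any-allFin⁺ (n G) _ x (∧-i (T→≡ (<⇒<ᵇ lt)) rxy))) (not-t ry))

  isRep-unique : ∀ {x y} → isRep G S x ≡ true → isRep G S y ≡ true → Conn S x y → x ≡ y
  isRep-unique {x} {y} rx ry rxy with <-cmp (toℕ x) (toℕ y)
  ... | tri< a _ _ = ⊥-elim (isRep-least ry rxy a)
  ... | tri≈ _ b _ = FP.toℕ-injective b
  ... | tri> _ _ c = ⊥-elim (isRep-least rx (Conn-sym rxy) c)

  compSize-Conn : ∀ {x y} → Conn S x y → compSize G S x ≡ compSize G S y
  compSize-Conn {x} {y} r =
    trans (countᵇ-allFin (n G) _) (trans (count-cong (n G) same) (sym (countᵇ-allFin (n G) _)))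
    where
    same : ∀ z → conn G S x z ≡ conn G S y z
    same z = iff→≡ (Conn-trans (Conn-sym r)) (Conn-trans r)

  θ-representatives : (rs : List (V G)) → AllPairs (λ x y → ¬ Conn S x y) rs →
    (∀ x → Any (Conn S x) rs) → θ G S ↭ map (compSize G S) rs
  θ-representatives rs separated covering =
    ↭-trans (Perm.map⁺ (compSize G S) reps↭)
            (↭-reflexive (trans (sym (map-∘ rs)) (map-cong (λ r → compSize-Conn (rep-Conn r)) rs)))
    where
    reps = filterᵇ (isRep G S) (allFin (n G))
    reps-unique : Unique reps
    reps-unique = Unique.filter⁺ (T? ∘ isRep G S) (Unique.allFin⁺ (n G))
    rs-unique : Unique (map rep rs)
    rs-unique = AllPairs.map⁺ (AllPairs.map (λ {x} {y} nr e →
      nr (Conn-trans (Conn-sym (rep-Conn x)) (subst (λ z → Conn S z y) (sym e) (rep-Conn y)))) separated)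
    to : ∀ z → z ∈ reps → z ∈ map rep rs
    to z zi with find (covering z)
    ... | r , r∈ , rz = subst (_∈ map rep rs) (sym z≡rep) (∈-map⁺ rep r∈)
      where
      z≡rep : z ≡ rep r
      z≡rep = isRep-unique (T→≡ (proj₂ (∈-filter⁻ (T? ∘ isRep G S) {xs = allFin (n G)} zi)))
                           (rep-isRep r) (Conn-trans rz (Conn-sym (rep-Conn r)))
    from : ∀ z → z ∈ map rep rs → z ∈ reps
    from z zi with ∈-map⁻ rep zi
    ... | r , _ , refl = ∈-filter⁺ (T? ∘ isRep G S) (∈-allFin (rep r)) (≡→T (rep-isRep r))
    reps↭ : reps ↭ map rep rs
    reps↭ = ∼bag⇒↭ (unique∧set⇒bag reps-unique rs-unique λ {z} → mk⇔ (to z) (from z))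

-- A rooted tree is
-- recovered from it: nodes are the root (inj₁ tt) and the edges (inj₂ e,
-- standing for the lower end of e); the parent of e is the root if e is
-- nested in no other edge, and otherwise the least edge containing e.
module Nesting {Edge : Set} (nested : Edge → Edge → Bool) where

  Node : Set
  Node = ⊤ ⊎ Edge

  Parent : Edge → Node → Set
  Parent e (inj₁ _) = ∀ g → g ≢ e → nested g e ≡ false
  Parent e (inj₂ g) = g ≢ e × nested g e ≡ true × (∀ h → h ≢ e → nested h e ≡ true → nested h g ≡ true)

  NodeAdj : Node → Node → Set
  NodeAdj α β = Σ Edge λ e → (α ≡ inj₂ e × Parent e β) ⊎ (β ≡ inj₂ e × Parent e α)

module NestingTransfer {E₁ E₂ : Set} (nested₁ : E₁ → E₁ → Bool) (nested₂ : E₂ → E₂ → Bool)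
  (f : E₁ ↔ E₂) (preserves : ∀ e g → nested₂ (Inverse.to f e) (Inverse.to f g) ≡ nested₁ e g) where

  open Inverse f using (to; from; strictlyInverseˡ; strictlyInverseʳ)
  module N₁ = Nesting nested₁
  module N₂ = Nesting nested₂

  to-injective : ∀ {e g} → to e ≡ to g → e ≡ g
  to-injective {e} {g} eq = trans (sym (strictlyInverseʳ e)) (trans (cong from eq) (strictlyInverseʳ g))

  reflects : ∀ e' g' → nested₂ e' g' ≡ nested₁ (from e') (from g')
  reflects e' g' = trans (sym (cong₂ nested₂ (strictlyInverseˡ e') (strictlyInverseˡ g'))) (preserves (from e') (from g'))

  node : N₁.Node → N₂.Node
  node (inj₁ x) = inj₁ x
  node (inj₂ e) = inj₂ (to e)

  node⁻¹ : N₂.Node → N₁.Node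
  node⁻¹ (inj₁ x) = inj₁ x
  node⁻¹ (inj₂ e) = inj₂ (from e)

  nodes : N₁.Node ↔ N₂.Node
  nodes = mk↔ₛ′ node node⁻¹ inv₁ inv₂
    where
    inv₁ : ∀ y → node (node⁻¹ y) ≡ y
    inv₁ (inj₁ x) = refl
    inv₁ (inj₂ e) = cong inj₂ (strictlyInverseˡ e)
    inv₂ : ∀ x → node⁻¹ (node x) ≡ x
    inv₂ (inj₁ x) = refl
    inv₂ (inj₂ e) = cong inj₂ (strictlyInverseʳ e)

  Parent-to : ∀ e x → N₁.Parent e x → N₂.Parent (to e) (node x)
  Parent-to e (inj₁ _) top g' g'≢ = trans (reflects g' (to e))
    (trans (cong (nested₁ (from g')) (strictlyInverseʳ e))
           (top (from g') (λ eq → g'≢ (trans (sym (strictlyInverseˡ g')) (cong to eq)))))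
  Parent-to e (inj₂ g) (g≢e , e-in-g , least) = (λ eq → g≢e (to-injective eq)) , trans (preserves g e) e-in-g ,
    λ h' h'≢ e-in-h' → trans (reflects h' (to g)) (trans (cong (nested₁ (from h')) (strictlyInverseʳ g))
       (least (from h') (λ eq → h'≢ (trans (sym (strictlyInverseˡ h')) (cong to eq)))
          (trans (sym (cong (nested₁ (from h')) (strictlyInverseʳ e))) (trans (sym (reflects h' (to e))) e-in-h'))))

  Parent-from : ∀ e x → N₂.Parent (to e) (node x) → N₁.Parent e x
  Parent-from e (inj₁ _) top g g≢e = trans (sym (preserves g e)) (top (to g) (λ eq → g≢e (to-injective eq)))
  Parent-from e (inj₂ g) (g≢e , e-in-g , least) = (λ eq → g≢e (cong to eq)) , trans (sym (preserves g e)) e-in-g ,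
    λ h h≢e e-in-h → trans (sym (preserves h g)) (least (to h) (λ eq → h≢e (to-injective eq)) (trans (preserves h e) e-in-h))

  node-inj₂ : ∀ {α e'} → node α ≡ inj₂ e' → α ≡ inj₂ (from e')
  node-inj₂ {inj₂ e} refl = cong inj₂ (sym (strictlyInverseʳ e))

  NodeAdj-transfer : ∀ α β → N₁.NodeAdj α β ⇔ N₂.NodeAdj (node α) (node β)
  NodeAdj-transfer α β = mk⇔ forth back
    where
    forth : N₁.NodeAdj α β → N₂.NodeAdj (node α) (node β)
    forth (e , inj₁ (refl , p)) = to e , inj₁ (refl , Parent-to e β p)
    forth (e , inj₂ (refl , p)) = to e , inj₂ (refl , Parent-to e α p)
    parent-back : ∀ e' γ → N₂.Parent e' (node γ) → N₁.Parent (from e') γ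
    parent-back e' γ p = Parent-from (from e') γ (subst (λ z → N₂.Parent z (node γ)) (sym (strictlyInverseˡ e')) p)
    back : N₂.NodeAdj (node α) (node β) → N₁.NodeAdj α β
    back (e' , inj₁ (eq , p)) = from e' , inj₁ (node-inj₂ {α} eq , parent-back e' β p)
    back (e' , inj₂ (eq , p)) = from e' , inj₂ (node-inj₂ {β} eq , parent-back e' α p)

-- Every edge e has an upper end
-- (on the side of c once e is removed) and a lower end; `below e x` says
-- that removing e separates x from c, and `nested e g` that g hangs below e.
module Rooted (G : Graph) (t : IsTree G) (c : V G) where
  open Walks G

  keepAll : E G → Bool
  keepAll _ = false

  connected : ∀ u v → Conn keepAll u v
  connected = IsTree.connected t

  end₁ end₂ : E G → V G
  end₁ e = proj₁ (ends G e)
  end₂ e = proj₂ (ends G e)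

  edge-cut : ∀ e → ¬ Conn (single e) (end₁ e) (end₂ e)
  edge-cut e = acyclic-cut (IsTree.acyclic t) e _ _ (inj₁ refl)

  upper lower : E G → V G
  upper e = if conn G (single e) (end₁ e) c then end₁ e else end₂ e
  lower e = if conn G (single e) (end₁ e) c then end₂ e else end₁ e

  ends-lower-upper : ∀ e → (end₁ e ≡ lower e × end₂ e ≡ upper e) ⊎ (end₁ e ≡ upper e × end₂ e ≡ lower e)
  ends-lower-upper e with conn G (single e) (end₁ e) c
  ... | true = inj₂ (refl , refl)
  ... | false = inj₁ (refl , refl)

  at-ends : (P : V G → Set) → ∀ e → P (lower e) → P (upper e) → P (end₁ e) × P (end₂ e)
  at-ends P e pl pu with ends-lower-upper e
  ... | inj₁ (p , q) = subst P (sym p) pl , subst P (sym q) pu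
  ... | inj₂ (p , q) = subst P (sym p) pu , subst P (sym q) pl

  upper-Conn : ∀ e → Conn (single e) (upper e) c
  upper-Conn e with conn G (single e) (end₁ e) c in eq
  ... | true = eq
  ... | false with split keepAll e (end₁ e) c (connected _ _)
  ... | inj₁ r = ⊥-elim (t≢f (trans (sym r) eq))
  ... | inj₂ (inj₁ (_ , r)) = Conn-sym r
  ... | inj₂ (inj₂ (r , _)) = ⊥-elim (edge-cut e r)

  lower-cut : ∀ e → ¬ Conn (single e) (lower e) c
  lower-cut e r with conn G (single e) (end₁ e) c in eq
  ... | true = edge-cut e (Conn-trans eq (Conn-sym r))
  ... | false = t≢f (trans (sym r) eq)

  joins-lower-upper : ∀ e → joins G e (lower e) (upper e)
  joins-lower-upper e with ends-lower-upper e
  ... | inj₁ (p , q) = inj₁ (cong₂ _,_ p q)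
  ... | inj₂ (p , q) = inj₂ (cong₂ _,_ p q)

  lower≢upper : ∀ e → lower e ≢ upper e
  lower≢upper e eq = lower-cut e (subst (λ z → Conn (single e) z c) (sym eq) (upper-Conn e))

  lower≢root : ∀ e → lower e ≢ c
  lower≢root e eq = lower-cut e (subst (λ z → Conn (single e) z c) (sym eq) (Conn-refl c))

  joins⇒lower-upper : ∀ {e x y} → joins G e x y → (x ≡ lower e × y ≡ upper e) ⊎ (x ≡ upper e × y ≡ lower e)
  joins⇒lower-upper {e} (inj₁ eq) with ends-lower-upper e
  ... | inj₁ (p , q) = inj₁ (trans (sym (cong proj₁ eq)) p , trans (sym (cong proj₂ eq)) q)
  ... | inj₂ (p , q) = inj₂ (trans (sym (cong proj₁ eq)) p , trans (sym (cong proj₂ eq)) q)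
  joins⇒lower-upper {e} (inj₂ eq) with ends-lower-upper e
  ... | inj₁ (p , q) = inj₂ (trans (sym (cong proj₂ eq)) q , trans (sym (cong proj₁ eq)) p)
  ... | inj₂ (p , q) = inj₁ (trans (sym (cong proj₂ eq)) q , trans (sym (cong proj₁ eq)) p)

  Side : E G → V G → Set
  Side e x = Conn (single e) x c ⊎ Conn (single e) x (lower e)

  Side-Conn : ∀ {e x y} → Conn (single e) x y → Side e y → Side e x
  Side-Conn r (inj₁ r') = inj₁ (Conn-trans r r')
  Side-Conn r (inj₂ r') = inj₂ (Conn-trans r r')

  side : ∀ e x → Side e x
  side e x with split keepAll e c x (connected _ _)
  ... | inj₁ r = inj₁ (Conn-sym r)
  ... | inj₂ (inj₁ (_ , r)) = Side-Conn r (proj₂ ends-sides)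
    where ends-sides = at-ends (Side e) e (inj₂ (Conn-refl _)) (inj₁ (upper-Conn e))
  ... | inj₂ (inj₂ (_ , r)) = Side-Conn r (proj₁ ends-sides)
    where ends-sides = at-ends (Side e) e (inj₂ (Conn-refl _)) (inj₁ (upper-Conn e))

  below : E G → V G → Bool
  below e x = not (conn G (single e) x c)

  below⇒cut : ∀ {e x} → below e x ≡ true → ¬ Conn (single e) x c
  below⇒cut d r = t≢f (trans (sym r) (not-t d))

  cut⇒below : ∀ {e x} → ¬ Conn (single e) x c → below e x ≡ true
  cut⇒below n = not-f (¬t→f n)

  ¬below⇒Conn : ∀ {e x} → below e x ≡ false → Conn (single e) x c
  ¬below⇒Conn {e} {x} d with conn G (single e) x c
  ... | true = refl

  lower-below : ∀ e → below e (lower e) ≡ true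
  lower-below e = cut⇒below (lower-cut e)

  below⇒Conn-lower : ∀ {e x} → below e x ≡ true → Conn (single e) x (lower e)
  below⇒Conn-lower {e} {x} d with side e x
  ... | inj₁ r = ⊥-elim (below⇒cut d r)
  ... | inj₂ r = r

  Conn-lower⇒below : ∀ {e x} → Conn (single e) x (lower e) → below e x ≡ true
  Conn-lower⇒below {e} r = cut⇒below (λ r' → lower-cut e (Conn-trans (Conn-sym r) r'))

  below-closed : ∀ {e x y} → Conn (single e) x y → below e y ≡ true → below e x ≡ true
  below-closed r d = Conn-lower⇒below (Conn-trans r (below⇒Conn-lower d))

  not-below-closed : ∀ {e x y} → Conn (single e) x y → below e y ≡ false → below e x ≡ false
  not-below-closed r d = ¬t→f (λ dx → f→¬t d (below-closed (Conn-sym r) dx))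

  nested : E G → E G → Bool
  nested e g = below e (lower g)

  Conn-pair⇒₁ : ∀ {e g x y} → Conn (pair e g) x y → Conn (single e) x y
  Conn-pair⇒₁ = Conn-mono (λ h → ∨-false₁)

  Conn-pair⇒₂ : ∀ {e g x y} → Conn (pair e g) x y → Conn (single g) x y
  Conn-pair⇒₂ {e} = Conn-mono (λ h → ∨-false₂ {h == e})

  Conn-pair-swap : ∀ {e g x y} → Conn (pair g e) x y → Conn (pair e g) x y
  Conn-pair-swap {e} {g} = Conn-mono (λ h p → trans (∨-comm (h == e) (h == g)) p)

  conn-pair-swap : ∀ e g x y → conn G (pair e g) x y ≡ conn G (pair g e) x y
  conn-pair-swap e g x y = iff→≡ (Conn-pair-swap {g} {e}) (Conn-pair-swap {e} {g})

  upper-in-pair-cut : ∀ e g → Conn (pair e g) (upper e) c ⊎ Conn (pair e g) (upper e) (lower g)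
  upper-in-pair-cut e g with split (single e) g c (upper e) (Conn-sym (upper-Conn e))
  ... | inj₁ r = inj₁ (Conn-sym r)
  ... | inj₂ (inj₁ (r1 , r2)) with ends-lower-upper g
  ...   | inj₁ (p , q) = ⊥-elim (lower-cut g (Conn-sym (Conn-pair⇒₂ {e} (subst (Conn _ c) p r1))))
  ...   | inj₂ (p , q) = inj₂ (subst (Conn _ (upper e)) q r2)
  upper-in-pair-cut e g | inj₂ (inj₂ (r1 , r2)) with ends-lower-upper g
  ...   | inj₁ (p , q) = inj₂ (subst (Conn _ (upper e)) p r2)
  ...   | inj₂ (p , q) = ⊥-elim (lower-cut g (Conn-sym (Conn-pair⇒₂ {e} (subst (Conn _ c) q r1))))

  nested-antisym : ∀ e g → e ≢ g → nested e g ≡ true → nested g e ≡ true → ⊥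
  nested-antisym e g ne neg nge with upper-in-pair-cut e g
  ... | inj₁ r = below⇒cut nge (Conn-trans (Conn-edge e (==-false ne) (joins-lower-upper e)) (Conn-pair⇒₂ {e} r))
  ... | inj₂ r = below⇒cut neg (Conn-trans (Conn-sym (Conn-pair⇒₁ {e} {g} r)) (upper-Conn e))

  ThreeSides : E G → E G → V G → Set
  ThreeSides e g x = Conn (pair e g) x c ⊎ Conn (pair e g) x (lower e) ⊎ Conn (pair e g) x (lower g)

  ThreeSides-Conn : ∀ {e g x y} → Conn (pair e g) x y → ThreeSides e g y → ThreeSides e g x
  ThreeSides-Conn r (inj₁ r') = inj₁ (Conn-trans r r')
  ThreeSides-Conn r (inj₂ (inj₁ r')) = inj₂ (inj₁ (Conn-trans r r'))
  ThreeSides-Conn r (inj₂ (inj₂ r')) = inj₂ (inj₂ (Conn-trans r r'))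

  ends-ThreeSides : ∀ e g → ThreeSides e g (end₁ e) × ThreeSides e g (end₂ e)
  ends-ThreeSides e g = at-ends (ThreeSides e g) e (inj₂ (inj₁ (Conn-refl _))) upper-side
    where
    upper-side : ThreeSides e g (upper e)
    upper-side with upper-in-pair-cut e g
    ... | inj₁ r = inj₁ r
    ... | inj₂ r = inj₂ (inj₂ r)

  -- Walking from r0 to x avoiding g, removing e too only cuts at an end of e.
  ThreeSides-spread : ∀ {e g r0 x} → Conn (single g) r0 x → ThreeSides e g r0 → ThreeSides e g x
  ThreeSides-spread {e} {g} {r0} {x} r side-r0 with split (single g) e r0 x r
  ... | inj₁ r' = ThreeSides-Conn (Conn-sym (Conn-pair-swap r')) side-r0
  ... | inj₂ (inj₁ (_ , r')) = ThreeSides-Conn (Conn-pair-swap r') (proj₂ (ends-ThreeSides e g))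
  ... | inj₂ (inj₂ (_ , r')) = ThreeSides-Conn (Conn-pair-swap r') (proj₁ (ends-ThreeSides e g))

  three-sides : ∀ e g x → ThreeSides e g x
  three-sides e g x with side g x
  ... | inj₁ r = ThreeSides-spread (Conn-sym r) (inj₁ (Conn-refl c))
  ... | inj₂ r = ThreeSides-spread (Conn-sym r) (inj₂ (inj₂ (Conn-refl (lower g))))

  conn-pair-root : ∀ e g x → conn G (pair e g) c x ≡ (not (below e x) ∧ not (below g x))
  conn-pair-root e g x = iff→≡ to from
    where
    to : Conn (pair e g) c x → (not (below e x) ∧ not (below g x)) ≡ true
    to r = ∧-i (not-f (¬t→f (λ d → below⇒cut d (Conn-sym (Conn-pair⇒₁ {e} {g} r)))))
               (not-f (¬t→f (λ d → below⇒cut d (Conn-sym (Conn-pair⇒₂ {e} {g} r)))))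
    from : (not (below e x) ∧ not (below g x)) ≡ true → Conn (pair e g) c x
    from h with three-sides e g x
    ... | inj₁ r = Conn-sym r
    ... | inj₂ (inj₁ r) = ⊥-elim (f→¬t (not-t (∧-l h)) (Conn-lower⇒below (Conn-pair⇒₁ {e} {g} r)))
    ... | inj₂ (inj₂ r) = ⊥-elim (f→¬t (not-t (∧-r {not (below e x)} h)) (Conn-lower⇒below (Conn-pair⇒₂ {e} {g} r)))

  conn-pair-lower-disjoint : ∀ e g x → nested g e ≡ false →
    conn G (pair e g) (lower e) x ≡ (below e x ∧ not (below g x))
  conn-pair-lower-disjoint e g x q = iff→≡ to from
    where
    to : Conn (pair e g) (lower e) x → (below e x ∧ not (below g x)) ≡ true
    to r = ∧-i (Conn-lower⇒below (Conn-sym (Conn-pair⇒₁ {e} {g} r)))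
               (not-f (not-below-closed (Conn-sym (Conn-pair⇒₂ {e} {g} r)) q))
    from : (below e x ∧ not (below g x)) ≡ true → Conn (pair e g) (lower e) x
    from h with three-sides e g x
    ... | inj₁ r = ⊥-elim (below⇒cut (∧-l h) (Conn-pair⇒₁ {e} {g} r))
    ... | inj₂ (inj₁ r) = Conn-sym r
    ... | inj₂ (inj₂ r) = ⊥-elim (f→¬t (not-t (∧-r {below e x} h)) (Conn-lower⇒below (Conn-pair⇒₂ {e} {g} r)))

  conn-pair-lower : ∀ e g x → nested e g ≡ false → conn G (pair e g) (lower e) x ≡ below e x
  conn-pair-lower e g x p = iff→≡ to from
    where
    to : Conn (pair e g) (lower e) x → below e x ≡ true
    to r = Conn-lower⇒below (Conn-sym (Conn-pair⇒₁ {e} {g} r))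
    from : below e x ≡ true → Conn (pair e g) (lower e) x
    from h with three-sides e g x
    ... | inj₁ r = ⊥-elim (below⇒cut h (Conn-pair⇒₁ {e} {g} r))
    ... | inj₂ (inj₁ r) = Conn-sym r
    ... | inj₂ (inj₂ r) = ⊥-elim (f→¬t p (below-closed (Conn-sym (Conn-pair⇒₁ {e} {g} r)) h))

  below-included : ∀ e g x → nested e g ≡ true → nested g e ≡ false → below g x ≡ true → below e x ≡ true
  below-included e g x p q d with three-sides e g x
  ... | inj₁ r = ⊥-elim (below⇒cut d (Conn-pair⇒₂ {e} {g} r))
  ... | inj₂ (inj₁ r) = ⊥-elim (f→¬t (not-below-closed (Conn-pair⇒₂ {e} {g} r) q) d)
  ... | inj₂ (inj₂ r) = below-closed (Conn-pair⇒₁ {e} {g} r) p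

  lower-injective : ∀ {e g} → lower e ≡ lower g → e ≡ g
  lower-injective {e} {g} eq with e FP.≟ g
  ... | yes p = p
  ... | no ne = ⊥-elim (nested-antisym e g ne (subst (λ z → below e z ≡ true) eq (lower-below e))
                                             (subst (λ z → below g z ≡ true) (sym eq) (lower-below g)))

  path-avoiding : ∀ {S u k v vs es} h → Path S u k (v ∷ vs) es → (∀ j → h ≢ lookup es j) →
    Conn (single h) u v
  path-avoiding h pnil _ = Conn-refl _
  path-avoiding h (psnoc P h' sh jn ni) av =
    Conn-trans (path-avoiding h P (λ j → av (fsuc j))) (Conn-edge h' (==-false (λ e → av fzero (sym e))) jn)

  -- A vertex v ≠ c is the lower end of the last edge of a path from c to v.
  lower-onto : ∀ v → v ≢ c → Σ (E G) λ e → lower e ≡ v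
  lower-onto v ne with erase (conn→Walk (connected c v))
  ... | _ , _ , _ , pnil = ⊥-elim (ne refl)
  ... | _ , _ , _ , psnoc {p = p} P h sh jn fresh = h , lower≡v (joins⇒lower-upper {h} jn)
    where
    c~p : Conn (single h) c p
    c~p = path-avoiding h P (new-edge P jn fresh)
    lower≡v : (p ≡ lower h × v ≡ upper h) ⊎ (p ≡ upper h × v ≡ lower h) → lower h ≡ v
    lower≡v (inj₁ (p≡l , _)) = ⊥-elim (lower-cut h (subst (λ z → Conn (single h) z c) p≡l (Conn-sym c~p)))
    lower≡v (inj₂ (_ , v≡l)) = sym v≡l

  -- The tree is recovered from `nested`: vertices are coded as the root or
  -- an edge (its lower end), and the upper end of e is the node that
  -- `Nesting.Parent` describes.
  open Nesting nested

  decode : Node → V G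
  decode (inj₁ _) = c
  decode (inj₂ e) = lower e

  encode : V G → Node
  encode v with v FP.≟ c
  ... | yes _ = inj₁ tt
  ... | no v≢c = inj₂ (proj₁ (lower-onto v v≢c))

  decode-encode : ∀ v → decode (encode v) ≡ v
  decode-encode v with v FP.≟ c
  ... | yes eq = sym eq
  ... | no v≢c = proj₂ (lower-onto v v≢c)

  encode-decode : ∀ x → encode (decode x) ≡ x
  encode-decode (inj₁ tt) with c FP.≟ c
  ... | yes _ = refl
  ... | no c≢c = ⊥-elim (c≢c refl)
  encode-decode (inj₂ e) with lower e FP.≟ c
  ... | yes eq = ⊥-elim (lower≢root e eq)
  ... | no l≢c = cong inj₂ (lower-injective (proj₂ (lower-onto (lower e) l≢c)))

  code : V G ↔ Node
  code = mk↔ₛ′ encode decode encode-decode decode-encode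

  upper-cases : ∀ e → (upper e ≡ c) ⊎ (Σ (E G) λ g → lower g ≡ upper e)
  upper-cases e with upper e FP.≟ c
  ... | yes eq = inj₁ eq
  ... | no u≢c = inj₂ (lower-onto (upper e) u≢c)

  edge-kept : ∀ {e g} → g ≢ e → Conn (single g) (lower e) (upper e)
  edge-kept g≢e = Conn-edge _ (==-false (λ eq → g≢e (sym eq))) (joins-lower-upper _)

  upper-not-below : ∀ e → below e (upper e) ≡ false
  upper-not-below e = ¬t→f (λ d → below⇒cut d (upper-Conn e))

  root-not-below : ∀ e → below e c ≡ false
  root-not-below e = ¬t→f (λ d → below⇒cut d (Conn-refl c))

  nested⇒upper-below : ∀ g h → h ≢ g → nested g h ≡ true → below g (upper h) ≡ true
  nested⇒upper-below g h h≢g d = below-closed (Conn-sym (edge-kept (λ eq → h≢g (sym eq)))) d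

  parent-root : ∀ e → upper e ≡ c → Parent e (inj₁ tt)
  parent-root e u≡c g g≢e = ¬t→f (λ d → below⇒cut d (subst (Conn _ (lower e)) u≡c (edge-kept g≢e)))

  parent-edge : ∀ e g → upper e ≡ lower g → Parent e (inj₂ g)
  parent-edge e g u≡l = g≢e , e-in-g , least
    where
    g≢e : g ≢ e
    g≢e refl = lower≢upper e (sym u≡l)
    e-in-g : nested g e ≡ true
    e-in-g = below-closed (subst (Conn _ (lower e)) u≡l (edge-kept g≢e)) (lower-below g)
    least : ∀ h → h ≢ e → nested h e ≡ true → nested h g ≡ true
    least h h≢e d = subst (λ z → below h z ≡ true) u≡l (below-closed (Conn-sym (edge-kept h≢e)) d)

  lower⇒encode : ∀ {v e} → v ≡ lower e → encode v ≡ inj₂ e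
  lower⇒encode {e = e} refl = encode-decode (inj₂ e)

  encode⇒lower : ∀ {v e} → encode v ≡ inj₂ e → v ≡ lower e
  encode⇒lower {v} eq = trans (sym (decode-encode v)) (cong decode eq)

  upper-Parent : ∀ e → Parent e (encode (upper e))
  upper-Parent e with upper-cases e
  ... | inj₁ u≡c = subst (Parent e) (sym (trans (cong encode u≡c) (encode-decode (inj₁ tt)))) (parent-root e u≡c)
  ... | inj₂ (g , l≡u) = subst (Parent e) (sym (lower⇒encode (sym l≡u))) (parent-edge e g (sym l≡u))

  Parent-unique : ∀ e x y → Parent e x → Parent e y → x ≡ y
  Parent-unique e (inj₁ _) (inj₁ _) _ _ = refl
  Parent-unique e (inj₁ _) (inj₂ g) top (g≢e , e-in-g , _) = ⊥-elim (t≢f (trans (sym e-in-g) (top g g≢e)))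
  Parent-unique e (inj₂ g) (inj₁ _) (g≢e , e-in-g , _) top = ⊥-elim (t≢f (trans (sym e-in-g) (top g g≢e)))
  Parent-unique e (inj₂ g) (inj₂ g') (g≢e , e-in-g , least) (g'≢e , e-in-g' , least') with g FP.≟ g'
  ... | yes eq = cong inj₂ eq
  ... | no g≢g' = ⊥-elim (nested-antisym g g' g≢g' (least' g g≢e e-in-g) (least g' g'≢e e-in-g'))

  Parent⇒upper : ∀ e x → Parent e x → upper e ≡ decode x
  Parent⇒upper e x p =
    trans (sym (decode-encode (upper e))) (cong decode (Parent-unique e _ x (upper-Parent e) p))

  Adj⇔NodeAdj : ∀ u v → Adj G u v ⇔ NodeAdj (encode u) (encode v)
  Adj⇔NodeAdj u v = mk⇔ forth back
    where
    parent-of : ∀ e w → w ≡ upper e → Parent e (encode w)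
    parent-of e w refl = upper-Parent e
    forth : Adj G u v → NodeAdj (encode u) (encode v)
    forth (e , jn) with joins⇒lower-upper {e} jn
    ... | inj₁ (u≡l , v≡u) = e , inj₁ (lower⇒encode u≡l , parent-of e v v≡u)
    ... | inj₂ (u≡u , v≡l) = e , inj₂ (lower⇒encode v≡l , parent-of e u u≡u)
    ends-from : ∀ e w → Parent e (encode w) → upper e ≡ w
    ends-from e w p = trans (Parent⇒upper e (encode w) p) (decode-encode w)
    back : NodeAdj (encode u) (encode v) → Adj G u v
    back (e , inj₁ (eq , p)) = e , subst₂ (joins G e) (sym (encode⇒lower eq)) (ends-from e v p) (joins-lower-upper e)
    back (e , inj₂ (eq , p)) = e , joins-sym {G} (subst₂ (joins G e) (sym (encode⇒lower eq)) (ends-from e u p) (joins-lower-upper e))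

smaller-of-two : ∀ {s t s' t' : ℕ} → (t' ∷ s' ∷ []) ↭ (t ∷ s ∷ []) → s < t → s' < t' → s' ≡ s
smaller-of-two σ s<t s'<t' with ∈-resp-↭ σ (there (here refl)) | ∈-resp-↭ σ (here refl)
... | there (here s'≡s) | _ = s'≡s
... | here s'≡t | here t'≡t = ⊥-elim (<-irrefl (trans s'≡t (sym t'≡t)) s'<t')
... | here s'≡t | there (here t'≡s) = ⊥-elim (<-asym s<t (subst₂ _<_ s'≡t t'≡s s'<t'))

module Profile (G : Graph) (t : IsTree G) (c : V G) where
  open Walks G
  open Rooted G t c

  size coSize : E G → ℕ
  size e = count (n G) (below e)
  coSize e = count (n G) (λ x → not (below e x))

  compSize≡count : ∀ S r → compSize G S r ≡ count (n G) (conn G S r)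
  compSize≡count S r = countᵇ-allFin (n G) (conn G S r)

  θ-single : ∀ e → θ G (single e) ↭ (coSize e ∷ size e ∷ [])
  θ-single e = ↭-trans (Representatives.θ-representatives G (single e) (c ∷ lower e ∷ []) separated covering)
    (↭-reflexive (cong₂ _∷_ (trans (compSize≡count _ c) (count-cong (n G) root-side))
                    (cong₂ _∷_ (trans (compSize≡count _ (lower e)) (count-cong (n G) lower-side)) refl)))
    where
    separated = ((λ r → lower-cut e (Conn-sym r)) ∷ []) ∷ [] ∷ []
    covering : ∀ x → Any (Conn (single e) x) (c ∷ lower e ∷ [])
    covering x with side e x
    ... | inj₁ r = here r
    ... | inj₂ r = there (here r)
    root-side : ∀ x → conn G (single e) c x ≡ not (below e x)
    root-side x = trans (iff→≡ Conn-sym Conn-sym) (sym (not-involutive _))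
    lower-side : ∀ x → conn G (single e) (lower e) x ≡ below e x
    lower-side x = iff→≡ (λ r → Conn-lower⇒below (Conn-sym r)) (λ d → Conn-sym (below⇒Conn-lower d))

  θ-pair : ∀ e g → e ≢ g → θ G (pair e g) ↭
    (count (n G) (conn G (pair e g) c) ∷ count (n G) (conn G (pair e g) (lower e)) ∷ count (n G) (conn G (pair e g) (lower g)) ∷ [])
  θ-pair e g e≢g = ↭-trans (Representatives.θ-representatives G (pair e g) (c ∷ lower e ∷ lower g ∷ []) separated covering)
    (↭-reflexive (cong₂ _∷_ (compSize≡count _ c) (cong₂ _∷_ (compSize≡count _ (lower e))
                   (cong₂ _∷_ (compSize≡count _ (lower g)) refl))))
    where
    lowers-apart : ¬ Conn (pair e g) (lower e) (lower g)
    lowers-apart r with nested e g in p | nested g e in q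
    ... | false | _ = lower-cut e (Conn-trans (Conn-pair⇒₁ {e} {g} r) (¬below⇒Conn p))
    ... | true | false = lower-cut g (Conn-trans (Conn-sym (Conn-pair⇒₂ {e} {g} r)) (¬below⇒Conn q))
    ... | true | true = nested-antisym e g e≢g p q
    separated = ((λ r → lower-cut e (Conn-sym (Conn-pair⇒₁ {e} {g} r)))
                ∷ (λ r → lower-cut g (Conn-sym (Conn-pair⇒₂ {e} {g} r))) ∷ [])
              ∷ (lowers-apart ∷ []) ∷ [] ∷ []
    covering : ∀ x → Any (Conn (pair e g) x) (c ∷ lower e ∷ lower g ∷ [])
    covering x with three-sides e g x
    ... | inj₁ r = here r
    ... | inj₂ (inj₁ r) = there (here r)
    ... | inj₂ (inj₂ r) = there (there (here r))

  size-in-θ-pair : ∀ e g → e ≢ g → nested e g ≡ false → size e ∈ θ G (pair e g)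
  size-in-θ-pair e g e≢g p =
    ∈-resp-↭ (↭-sym (θ-pair e g e≢g)) (there (here (count-cong (n G) (λ x → sym (conn-pair-lower e g x p)))))

  module Balanced (balanced : ∀ e → size e < coSize e) where

    -- If g hangs below e, all three components differ in size from the
    -- subtree below e: the root component is its complement (larger), the
    -- other two are proper parts of it (smaller).
    size-notin-θ-pair : ∀ e g → e ≢ g → nested e g ≡ true → size e ∉ θ G (pair e g)
    size-notin-θ-pair e g e≢g p size∈ = excluded (∈-resp-↭ (θ-pair e g e≢g) size∈)
      where
      q : nested g e ≡ false
      q = ¬t→f (nested-antisym e g e≢g p)
      g⊆e : ∀ x → below g x ≡ true → below e x ≡ true
      g⊆e x = below-included e g x p q
      root-size : count (n G) (conn G (pair e g) c) ≡ coSize e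
      root-size = count-cong (n G) λ x → trans (conn-pair-root e g x) (outside x)
        where
        outside : ∀ x → (not (below e x) ∧ not (below g x)) ≡ not (below e x)
        outside x with below e x in d | below g x in d'
        ... | true | _ = refl
        ... | false | false = refl
        ... | false | true = ⊥-elim (t≢f (trans (sym (g⊆e x d')) d))
      lower-e-smaller : count (n G) (conn G (pair e g) (lower e)) < size e
      lower-e-smaller = subst (_< size e) (sym (count-cong (n G) (λ x → conn-pair-lower-disjoint e g x q)))
        (count-mono-strict (n G) (λ x → ∧-l) (lower g) (∧-false-at (lower-below g)) p)
        where
        ∧-false-at : ∀ {a b} → b ≡ true → (a ∧ not b) ≡ false
        ∧-false-at {a} refl = ∧-zeroʳ a
      lower-g-smaller : count (n G) (conn G (pair e g) (lower g)) < size e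
      lower-g-smaller = subst (_< size e) (sym (count-cong (n G) (λ x → trans (conn-pair-swap e g (lower g) x) (conn-pair-lower g e x q))))
        (count-mono-strict (n G) g⊆e (lower e) q (lower-below e))
      excluded : size e ∉ (count (n G) (conn G (pair e g) c) ∷ count (n G) (conn G (pair e g) (lower e))
                             ∷ count (n G) (conn G (pair e g) (lower g)) ∷ [])
      excluded (here eq) = <-irrefl (trans eq root-size) (balanced e)
      excluded (there (here eq)) = <-irrefl (sym eq) lower-e-smaller
      excluded (there (there (here eq))) = <-irrefl (sym eq) lower-g-smaller

    nested⇔size∉θ : ∀ e g → e ≢ g → nested e g ≡ true ⇔ size e ∉ θ G (pair e g)
    nested⇔size∉θ e g e≢g = mk⇔ (size-notin-θ-pair e g e≢g) back
      where
      back : size e ∉ θ G (pair e g) → nested e g ≡ true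
      back size∉ with nested e g in p
      ... | true = refl
      ... | false = ⊥-elim (size∉ (size-in-θ-pair e g e≢g p))

allSubsets-complete : ∀ k (F : Vec Bool k) → F ∈ allSubsets k
allSubsets-complete zero [] = here refl
allSubsets-complete (suc k) (false ∷ F) = ∈-concatMap⁺ _ (lose (allSubsets-complete k F) (here refl))
allSubsets-complete (suc k) (true ∷ F) = ∈-concatMap⁺ _ (lose (allSubsets-complete k F) (there (here refl)))

max-upper : ∀ {A : Set} (g : A → ℕ) xs x → x ∈ xs → g x ≤ foldr _⊔_ 0 (map g xs)
max-upper g (y ∷ xs) x (here refl) = m≤m⊔n (g x) _
max-upper g (y ∷ xs) x (there i) = ≤-trans (max-upper g xs x i) (m≤n⊔m (g y) _)

max-least : ∀ {A : Set} (g : A → ℕ) xs B → (∀ x → g x ≤ B) → foldr _⊔_ 0 (map g xs) ≤ B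
max-least g [] B h = z≤n
max-least g (x ∷ xs) B h = ⊔-lub (h x) (max-least g xs B h)

module Weight (G : Graph) where
  open Walks G

  edgeCount : Vec Bool (m G) → ℕ
  edgeCount F = count (m G) (lookup F)

  -- The edges outside F: connection avoiding them is connection within F.
  outside : Vec Bool (m G) → E G → Bool
  outside F e = not (lookup F e)

  weight-≥ : ∀ v F → leafSubtree G v F ≡ true → edgeCount F ≤ weight G v
  weight-≥ v F ls = ≤-trans (≤-reflexive counted) (max-upper _ (allSubsets (m G)) F (allSubsets-complete (m G) F))
    where
    counted : edgeCount F ≡ (if leafSubtree G v F then countᵇ (lookup F) (allFin (m G)) else 0)
    counted rewrite ls = sym (countᵇ-allFin (m G) _)

  weight-≤ : ∀ v B → (∀ F → leafSubtree G v F ≡ true → edgeCount F ≤ B) → weight G v ≤ B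
  weight-≤ v B bound = max-least _ (allSubsets (m G)) B each
    where
    each : ∀ F → (if leafSubtree G v F then countᵇ (lookup F) (allFin (m G)) else 0) ≤ B
    each F with leafSubtree G v F in ls
    ... | true = subst (_≤ B) (sym (countᵇ-allFin (m G) _)) (bound F ls)
    ... | false = z≤n

  leaf-degree : ∀ v F → leafSubtree G v F ≡ true → count (m G) (λ h → lookup F h ∧ incident G v h) ≡ 1
  leaf-degree v F ls = trans (sym (countᵇ-allFin (m G) _)) (toWitness {a? = degIn G F v Data.Nat.≟ 1} (≡→T (∧-l ls)))

  leaf-connected : ∀ v F → leafSubtree G v F ≡ true → ∀ x y → touched G F x ≡ true → touched G F y ≡ true →
    Conn (outside F) x y
  leaf-connected v F ls x y tx ty with conn G (outside F) x y in xy
  ... | true = refl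
  ... | false = ⊥-elim (t≢f (trans (sym (any-allFin⁺ (n G) _ x (any-allFin⁺ (n G) _ y gap)))
                                   (not-t (∧-r {⌊ degIn G F v Data.Nat.≟ 1 ⌋} ls))))
    where
    gap : (touched G F x ∧ touched G F y ∧ not (conn G (outside F) x y)) ≡ true
    gap rewrite tx | ty | xy = refl

  leafSubtree-intro : ∀ v F → count (m G) (λ h → lookup F h ∧ incident G v h) ≡ 1 →
    (∀ x y → touched G F x ≡ true → touched G F y ≡ true → Conn (outside F) x y) → leafSubtree G v F ≡ true
  leafSubtree-intro v F deg conn-F =
    ∧-i (T→≡ (fromWitness (trans (countᵇ-allFin (m G) _) deg)))
        (not-f (any-allFin-false (n G) _ λ x → any-allFin-false (n G) _ λ y → no-gap x y))
    where
    no-gap : ∀ x y → (touched G F x ∧ touched G F y ∧ not (conn G (outside F) x y)) ≡ false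
    no-gap x y with touched G F x in tx | touched G F y in ty
    ... | false | _ = refl
    ... | true | false = refl
    ... | true | true rewrite conn-F x y tx ty = refl

argmax : ∀ k (f : Fin k → ℕ) → Fin k → Σ (Fin k) λ j → ∀ i → f i ≤ f j
argmax (suc zero) f _ = fzero , λ { fzero → ≤-refl }
argmax (suc (suc k)) f _ with argmax (suc k) (λ i → f (fsuc i)) fzero
... | j , hj with f fzero ≤? f (fsuc j)
...   | yes le = fsuc j , λ { fzero → le ; (fsuc i) → hj i }
...   | no nle = fzero , λ { fzero → ≤-refl ; (fsuc i) → ≤-trans (hj i) (<⇒≤ (≰⇒> nle)) }

module Centroid (G : Graph) (t : IsTree G) (c : V G) where
  open Walks G
  open Rooted G t c
  open Profile G t c using (size; coSize)
  open Weight G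

  incident⇒lower-upper : ∀ x e → incident G x e ≡ true → (x ≡ lower e) ⊎ (x ≡ upper e)
  incident⇒lower-upper x e i with ∨-e i | ends-lower-upper e
  ... | inj₁ p | inj₁ (q , _) = inj₁ (trans (==-sound p) q)
  ... | inj₁ p | inj₂ (q , _) = inj₂ (trans (==-sound p) q)
  ... | inj₂ p | inj₁ (_ , q) = inj₂ (trans (==-sound p) q)
  ... | inj₂ p | inj₂ (_ , q) = inj₁ (trans (==-sound p) q)

  joins-incident : ∀ {h y z} → joins G h y z → incident G y h ≡ true
  joins-incident {y = y} (inj₁ eq) rewrite eq = ∨-l _ (==-refl y)
  joins-incident {y = y} (inj₂ eq) rewrite eq = ∨-r (y == _) (==-refl y)

  lower-incident : ∀ e → incident G (lower e) e ≡ true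
  lower-incident e = joins-incident (joins-lower-upper e)

  upper-incident : ∀ e → incident G (upper e) e ≡ true
  upper-incident e = joins-incident (joins-sym {G} (joins-lower-upper e))

  -- The far side of the unique edge h0 of a leaf subtree F at v: if h0
  -- joins v and w, every other edge of F has its ends connected to w
  -- avoiding h0.  Injecting these edges h ↦ lower h into any vertex set X
  -- containing that side, and missing one point r0 of X, gives #F ≤ #X.
  module LeafBound (v : V G) (F : Vec Bool (m G)) (ls : leafSubtree G v F ≡ true) where

    leaf-edge : Σ (E G) λ h0 → (lookup F h0 ∧ incident G v h0) ≡ true
    leaf-edge = count-witness (m G) _ (≤-reflexive (sym (leaf-degree v F ls)))

    h0 : E G
    h0 = proj₁ leaf-edge

    h0-unique : ∀ h → lookup F h ≡ true → incident G v h ≡ true → h ≡ h0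
    h0-unique h fh ih = count-one-unique (m G) _ (leaf-degree v F ls) h h0 (∧-i fh ih) (proj₂ leaf-edge)

    far-side : ∀ w → joins G h0 v w → ∀ y → Conn (outside F) v y → (y ≡ v) ⊎ Conn (single h0) y w
    far-side w jw y = Conn-ind (λ y → (y ≡ v) ⊎ Conn (single h0) y w) (inj₁ refl) step
      where
      step : ∀ {y z} h → outside F h ≡ false → joins G h y z →
             (y ≡ v) ⊎ Conn (single h0) y w → (z ≡ v) ⊎ Conn (single h0) z w
      step h fh jn py with h FP.≟ h0
      step h fh jn py | yes refl with joins-end jn jw
      ... | inj₁ z≡v = inj₁ z≡v
      ... | inj₂ z≡w = inj₂ (subst (λ u → Conn _ u w) (sym z≡w) (Conn-refl w))
      step h fh jn (inj₁ refl) | no h≢h0 = ⊥-elim (h≢h0 (h0-unique h (not-injective′ fh) (joins-incident jn)))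
        where
        not-injective′ : ∀ {x} → not x ≡ false → x ≡ true
        not-injective′ {true} _ = refl
      step h fh jn (inj₂ r) | no h≢h0 = inj₂ (Conn-trans (Conn-sym (Conn-edge h (==-false h≢h0) jn)) r)

    other-edges-far : ∀ w → joins G h0 v w → ∀ h → lookup F h ≡ true → h ≢ h0 → ∀ y →
      incident G y h ≡ true → Conn (single h0) y w
    other-edges-far w jw h fh h≢h0 y iy
      with far-side w jw y (leaf-connected v F ls v y (any-allFin⁺ (m G) _ h0 (proj₂ leaf-edge))
                                                    (any-allFin⁺ (m G) _ h (∧-i fh iy)))
    ... | inj₁ refl = ⊥-elim (h≢h0 (h0-unique h fh iy))
    ... | inj₂ r = r

    edge-bound : ∀ w (X : V G → Bool) r0 → joins G h0 v w →
      (∀ y → Conn (single h0) y w → X y ≡ true) → (∀ h → h ≢ h0 → lower h ≢ r0) →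
      X r0 ≡ true → edgeCount F ≤ count (n G) X
    edge-bound w X r0 jw side⊆X r0-free r0∈X =
      subst₂ _≤_ (sym (count-remove (m G) (lookup F) h0 (∧-l (proj₂ leaf-edge))))
                 (sym (count-remove (n G) X r0 r0∈X))
        (s≤s (count-injection (m G) (n G) _ _ lower into (λ _ _ _ _ → lower-injective)))
      where
      not-h0 : ∀ h → (lookup F h ∧ not (h == h0)) ≡ true → h ≢ h0
      not-h0 h p = ==-false⁻ (not-t (∧-r {lookup F h} p))
      into : ∀ h → (lookup F h ∧ not (h == h0)) ≡ true → (X (lower h) ∧ not (lower h == r0)) ≡ true
      into h p = ∧-i (side⊆X (lower h) (other-edges-far w jw h (∧-l p) (not-h0 h p) (lower h) (lower-incident h)))
                     (not-f (==-false (r0-free h (not-h0 h p))))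

  -- A subtree with lower g as a leaf has at most coSize g edges if it
  -- leaves lower g through g, and at most size h0 ≤ size g edges if it
  -- leaves through an edge h0 hanging directly below lower g.
  leaf-at-lower-bound : ∀ g F → leafSubtree G (lower g) F ≡ true → edgeCount F ≤ coSize g ⊔ size g
  leaf-at-lower-bound g F ls = by-leaf-edge (incident⇒lower-upper (lower g) h0 (∧-r {lookup F h0} (proj₂ leaf-edge)))
    where
    open LeafBound (lower g) F ls
    by-leaf-edge : (lower g ≡ lower h0) ⊎ (lower g ≡ upper h0) → edgeCount F ≤ coSize g ⊔ size g
    by-leaf-edge (inj₁ l≡l) = ≤-trans (edge-bound (upper g) (λ x → not (below g x)) c joins-g root-side
                                                  (λ h _ → lower≢root h) (not-f (root-not-below g)))
                                      (m≤m⊔n _ _)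
      where
      g≡h0 : g ≡ h0
      g≡h0 = lower-injective l≡l
      joins-g : joins G h0 (lower g) (upper g)
      joins-g = subst (λ z → joins G z (lower g) (upper g)) g≡h0 (joins-lower-upper g)
      root-side : ∀ y → Conn (single h0) y (upper g) → not (below g y) ≡ true
      root-side y r = not-f (¬t→f (λ d → below⇒cut d
        (Conn-trans (subst (λ z → Conn (single z) y (upper g)) (sym g≡h0) r) (upper-Conn g))))
    by-leaf-edge (inj₂ l≡u) = ≤-trans (edge-bound (lower h0) (below h0) (lower h0) joins-h0 (λ y → Conn-lower⇒below)
                                                  (λ h h≢h0 eq → h≢h0 (lower-injective eq)) (lower-below h0))
                                      (≤-trans (count-mono (n G) (λ x → below-included g h0 x h0-in-g g-not-in-h0))
                                               (m≤n⊔m _ _))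
      where
      joins-h0 : joins G h0 (lower g) (lower h0)
      joins-h0 = subst (λ z → joins G h0 z (lower h0)) (sym l≡u) (joins-sym {G} (joins-lower-upper h0))
      h0-in-g : nested g h0 ≡ true
      h0-in-g = proj₁ (proj₂ (parent-edge h0 g (sym l≡u)))
      g-not-in-h0 : nested h0 g ≡ false
      g-not-in-h0 = subst (λ z → below h0 z ≡ false) (sym l≡u) (upper-not-below h0)

  -- An edge g with upper end c, together with all edges hanging below g,
  -- forms a subtree with the leaf c and size g edges.
  module RootSubtree (g : E G) (upper≡c : upper g ≡ c) where

    F : Vec Bool (m G)
    F = Data.Vec.tabulate (nested g)

    in-F : ∀ h → lookup F h ≡ nested g h
    in-F = lookup∘tabulate (nested g)

    leaf-degree-one : ∀ h → (lookup F h ∧ incident G c h) ≡ (h == g)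
    leaf-degree-one h with h FP.≟ g
    ... | yes refl = ∧-i (trans (in-F g) (lower-below g)) (subst (λ z → incident G z g ≡ true) upper≡c (upper-incident g))
    ... | no h≢g = ¬t→f not-at-root
      where
      not-at-root : (lookup F h ∧ incident G c h) ≡ true → ⊥
      not-at-root p with incident⇒lower-upper c h (∧-r {lookup F h} p)
      ... | inj₁ c≡l = t≢f (trans (sym (subst (λ z → below g z ≡ true) (sym c≡l) h∈F)) (root-not-below g))
        where h∈F = trans (sym (in-F h)) (∧-l p)
      ... | inj₂ c≡u = t≢f (trans (sym (subst (λ z → below g z ≡ true) (sym c≡u) (nested⇒upper-below g h h≢g h∈F)))
                                  (root-not-below g))
        where h∈F = trans (sym (in-F h)) (∧-l p)

    inner : ∀ x → below g x ≡ true → Conn (outside F) x (lower g)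
    inner x d = proj₂ (Conn-ind (λ y → below g y ≡ true × Conn (outside F) x y) (d , Conn-refl x) step (below⇒Conn-lower d))
      where
      step : ∀ {y z} h → single g h ≡ false → joins G h y z →
             below g y ≡ true × Conn (outside F) x y → below g z ≡ true × Conn (outside F) x z
      step {y} {z} h sh jn (dy , r) = dz , Conn-trans r (Conn-edge h h∈F jn)
        where
        dz : below g z ≡ true
        dz = below-closed (Conn-sym (Conn-edge h sh jn)) dy
        h∈F : outside F h ≡ false
        h∈F with joins⇒lower-upper {h} jn
        ... | inj₁ (y≡l , _) rewrite in-F h = subst (λ w → not (below g w) ≡ false) y≡l (cong not dy)
        ... | inj₂ (_ , z≡l) rewrite in-F h = subst (λ w → not (below g w) ≡ false) z≡l (cong not dz)

    touched-inner : ∀ x → touched G F x ≡ true → Conn (outside F) x (lower g)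
    touched-inner x tx with any-allFin⁻ (m G) _ tx
    ... | h , p with h FP.≟ g | incident⇒lower-upper x h (∧-r {lookup F h} p)
    ...   | _ | inj₁ refl = inner (lower h) (subst (_≡ true) (in-F h) (∧-l p))
    ...   | yes refl | inj₂ refl = Conn-sym (Conn-edge g g∈F (joins-lower-upper g))
      where
      g∈F : outside F g ≡ false
      g∈F rewrite in-F g | lower-below g = refl
    ...   | no h≢g | inj₂ refl = inner (upper h) (nested⇒upper-below g h h≢g (subst (_≡ true) (in-F h) (∧-l p)))

    is-leaf-subtree : leafSubtree G c F ≡ true
    is-leaf-subtree = leafSubtree-intro c F (trans (count-cong (m G) leaf-degree-one) (count-singleton (m G) g))
      (λ x y tx ty → Conn-trans (touched-inner x tx) (Conn-sym (touched-inner y ty)))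

    -- F has at least size g edges: v ↦ the edge with lower end v.
    size≤edgeCount : size g ≤ edgeCount F
    size≤edgeCount = subst (size g ≤_) (sym (count-cong (m G) in-F))
      (count-injection (n G) (m G) (below g) (nested g) edge-above into
        (λ x y px py eq → trans (sym (edge-above-lower x px)) (trans (cong lower eq) (edge-above-lower y py))))
      where
      below≢root : ∀ v → below g v ≡ true → v ≢ c
      below≢root v d refl = t≢f (trans (sym d) (root-not-below g))
      edge-above : V G → E G
      edge-above v with v FP.≟ c
      ... | yes _ = g
      ... | no v≢c = proj₁ (lower-onto v v≢c)
      edge-above-lower : ∀ v → below g v ≡ true → lower (edge-above v) ≡ v
      edge-above-lower v d with v FP.≟ c
      ... | yes v≡c = ⊥-elim (below≢root v d v≡c)
      ... | no v≢c = proj₂ (lower-onto v v≢c)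
      into : ∀ v → below g v ≡ true → nested g (edge-above v) ≡ true
      into v d = subst (λ w → below g w ≡ true) (sym (edge-above-lower v d)) d

    weight-root : size g ≤ weight G c
    weight-root = ≤-trans size≤edgeCount (weight-≥ c F is-leaf-subtree)

  heaviest-at-root : ∀ g → (∀ h → size h ≤ size g) → upper g ≡ c
  heaviest-at-root g heaviest with upper-cases g
  ... | inj₁ u≡c = u≡c
  ... | inj₂ (g' , l≡u) = ⊥-elim (<-irrefl refl (≤-trans (count-mono-strict (n G) inside (lower g') outside′ (lower-below g'))
                                                         (heaviest g')))
    where
    outside′ : below g (lower g') ≡ false
    outside′ = subst (λ z → below g z ≡ false) (sym l≡u) (upper-not-below g)
    inside : ∀ x → below g x ≡ true → below g' x ≡ true
    inside x = below-included g' g x (proj₁ (proj₂ (parent-edge g g' (sym l≡u)))) outside′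

  size+coSize : ∀ e → size e + coSize e ≡ n G
  size+coSize e = count-complement (n G) (below e)

  -- Otherwise take g of maximal size; then
  -- coSize g ≤ size g, so weight (lower g) ≤ size g ≤ weight c, although
  -- lower g ≠ c must have larger weight.
  centroid-balanced : (∀ v → v ≢ c → weight G c < weight G v) → ∀ e → size e < coSize e
  centroid-balanced single e with size e <? coSize e
  ... | yes small = small
  ... | no ¬small = ⊥-elim (<-irrefl refl (≤-trans (single (lower g) (lower≢root g))
                                                    (≤-trans weight-lower (RootSubtree.weight-root g at-root))))
    where
    g = proj₁ (argmax (m G) size e)
    heaviest : ∀ h → size h ≤ size g
    heaviest = proj₂ (argmax (m G) size e)
    at-root : upper g ≡ c
    at-root = heaviest-at-root g heaviest
    coSize-g≤coSize-e : coSize g ≤ coSize e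
    coSize-g≤coSize-e = +-cancelˡ-≤ (size e) (coSize g) (coSize e)
      (≤-trans (+-monoˡ-≤ (coSize g) (heaviest e)) (≤-reflexive (trans (size+coSize g) (sym (size+coSize e)))))
    coSize≤size : coSize g ≤ size g
    coSize≤size = ≤-trans coSize-g≤coSize-e (≤-trans (≮⇒≥ ¬small) (heaviest e))
    weight-lower : weight G (lower g) ≤ size g
    weight-lower = weight-≤ (lower g) (size g)
      (λ F ls → ≤-trans (leaf-at-lower-bound g F ls) (≤-reflexive (m≤n⇒m⊔n≡n coSize≤size)))

module Isomorphism (T T' : Graph) (t : IsTree T) (t' : IsTree T') (c : V T) (c' : V T')
  (f : E T ↔ E T')
  (balanced : ∀ e → Profile.size T t c e < Profile.coSize T t c e)
  (balanced' : ∀ e → Profile.size T' t' c' e < Profile.coSize T' t' c' e)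
  (same-single : ∀ e → θ T' (single (Inverse.to f e)) ↭ θ T (single e))
  (same-pair : ∀ e g → e ≢ g → θ T' (pair (Inverse.to f e) (Inverse.to f g)) ↭ θ T (pair e g)) where

  open Inverse f using (to; from; strictlyInverseʳ)
  module R = Rooted T t c
  module R' = Rooted T' t' c'
  module P = Profile T t c
  module P' = Profile T' t' c'

  -- The size below an edge is the smaller entry of θ of that edge.
  size-preserved : ∀ e → P'.size (to e) ≡ P.size e
  size-preserved e = smaller-of-two (↭-trans (↭-sym (P'.θ-single (to e))) (↭-trans (same-single e) (P.θ-single e)))
                                    (balanced e) (balanced' (to e))

  -- Nesting is decided by membership of a size in θ of a pair.
  nested-preserved : ∀ e g → R'.nested (to e) (to g) ≡ R.nested e g
  nested-preserved e g with e FP.≟ g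
  ... | yes refl = trans (R'.lower-below (to e)) (sym (R.lower-below e))
  ... | no e≢g = iff→≡ (λ n' → Equivalence.from B (λ s∈ → Equivalence.to B' n' (forth s∈)))
                       (λ n → Equivalence.from B' (λ s∈ → Equivalence.to B n (back s∈)))
    where
    to≢ : to e ≢ to g
    to≢ eq = e≢g (trans (sym (strictlyInverseʳ e)) (trans (cong from eq) (strictlyInverseʳ g)))
    B = Profile.Balanced.nested⇔size∉θ T t c balanced e g e≢g
    B' = Profile.Balanced.nested⇔size∉θ T' t' c' balanced' (to e) (to g) to≢
    forth : P.size e ∈ θ T (pair e g) → P'.size (to e) ∈ θ T' (pair (to e) (to g))
    forth s∈ = subst (_∈ _) (sym (size-preserved e)) (∈-resp-↭ (↭-sym (same-pair e g e≢g)) s∈)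
    back : P'.size (to e) ∈ θ T' (pair (to e) (to g)) → P.size e ∈ θ T (pair e g)
    back s∈ = ∈-resp-↭ (same-pair e g e≢g) (subst (_∈ _) (size-preserved e) s∈)

  open NestingTransfer R.nested R'.nested f nested-preserved using (nodes; NodeAdj-transfer)

  φ : V T ↔ V T'
  φ = ↔-trans R.code (↔-trans nodes (↔-sym R'.code))

  decoded-adjacency : ∀ α β → Nesting.NodeAdj R'.nested α β ⇔ Adj T' (R'.decode α) (R'.decode β)
  decoded-adjacency α β = ⇔-sym (subst₂ (λ a b → Adj T' (R'.decode α) (R'.decode β) ⇔ Nesting.NodeAdj R'.nested a b)
                                       (R'.encode-decode α) (R'.encode-decode β) (R'.Adj⇔NodeAdj (R'.decode α) (R'.decode β)))

  isomorphic : Isomorphic T T'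
  isomorphic = φ , λ u v → decoded-adjacency _ _ ⇔-∘ (NodeAdj-transfer _ _ ⇔-∘ R.Adj⇔NodeAdj u v)

theorem5p7 : (T T' : Graph) → IsTree T → IsTree T' →
    SingleCentroid T → SingleCentroid T' →
    (f : E T ↔ E T') →
    (∀ e → θ T' (single (Inverse.to f e)) ↭ θ T (single e)) →
    (∀ e e' → e ≢ e' → θ T' (pair (Inverse.to f e) (Inverse.to f e')) ↭ θ T (pair e e')) →
    Isomorphic T T'
theorem5p7 T T' t t' (c , c-centroid) (c' , c'-centroid) f same-single same-pair =
  Isomorphism.isomorphic T T' t t' c c' f
    (Centroid.centroid-balanced T t c c-centroid) (Centroid.centroid-balanced T' t' c' c'-centroid)
    same-single same-pair
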